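{- For integers $i,j,k\ge 0$, each of the following \textsc{flag coloring} positions (on the properly two-colored graphs described in the context) is a $\mathcal{P}$-position (Sprague–Grundy value $0$): $P_{0^{1+}2^i4^j6^1}$ with $i,j$ both odd; $P_{0^{1+}2^i4^j6^k}$ with $k\ge2$, $i$ even and $j$ odd; $P_{1^{1+}3^i5^j}$ with $i$ odd; $P_{2^i4^j}$ with either $i=0$ and $j\ne1$, or $i\ge2$ even and $j$ even, or $i\ge3$ odd and $j=0$; $P_{2^i4^j6^1}$ with either $i=j=0$ or $i\ge1$ and $j$ even; $P_{2^i4^j6^k}$ with $k\ge2$ and $j$ even; $P_{3^i5^j}$ with either $i=j=0$, or $i=1$, or $i\ge3$ odd and $j\ge1$.
   Context: \textsc{flag coloring} is an impartial two-player game played on a simple graph whose vertices are colored. A move consists of choosing a vertex $v$, of color $c$ say, and a color $c'\neq c$ that is the color of some vertex adjacent to $v$; then $v$ and every vertex of the connected component of the subgraph induced by color-$c$ vertices that contains $v$ are recolored $c'$. Play is under the normal play convention: a player unable to move loses. A position is a $\mathcal{P}$-position if the player to move has no winning strategy, equivalently its Sprague–Grundy value is $0$. Notation: all graphs below consist of two vertices $u,v$ joined by internally vertex-disjoint paths, properly two-colored, all path lengths having the same parity. $P_{2^i4^j6^k}$ denotes distinct vertices $u\neq v$ joined by $i$ paths of length $2$, $j$ paths of length $4$ and $k$ paths of length $6$ (and nothing else); $P_{2^i4^j}=P_{2^i4^j6^0}$. $P_{0^{1+}2^i4^j6^k}$ denotes the graph in which $u=v$ (a single vertex) together with $i$ paths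 of length 2, $j$ paths of length 4 and $k$ paths of length 6 from this vertex to itself; i.e. $i$ pendant vertices, $j$ cycles of length 4 and $k$ cycles of length 6, all sharing only that vertex. $P_{3^i5^j}$ denotes distinct non-adjacent $u,v$ joined by $i$ paths of length 3 and $j$ paths of length 5. $P_{1^{1+}3^i5^j}$ denotes the same graph with additionally the edge $uv$. -}

module Defs where

open import Data.Nat using (ℕ; zero; suc; _+_; _%_)
open import Data.Fin using (Fin; toℕ)
open import Data.List using (List; []; _∷_; _++_; length; lookup; replicate)
open import Data.List.Membership.Propositional using (_∈_)
open import Data.Product using (Σ; Σ-syntax; _×_; _,_)
open import Data.Sum using (_⊎_)
open import Relation.Binary.PropositionalEquality using (_≡_; _≢_)
open import Relation.Nullary using (¬_)

Even : ℕ → Set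
Even n = n % 2 ≡ 0

Odd : ℕ → Set
Odd n = n % 2 ≡ 1

record Graph : Set where
  field
    n     : ℕ
    edges : List (ℕ × ℕ)

open Graph public

Adj : (G : Graph) → Fin (n G) → Fin (n G) → Set
Adj G x y = ((toℕ x , toℕ y) ∈ edges G) ⊎ ((toℕ y , toℕ x) ∈ edges G)

Coloring : Graph → Set
Coloring G = Fin (n G) → ℕ

data Conn (G : Graph) (col : Coloring G) (c : ℕ) (x : Fin (n G)) : Fin (n G) → Set where
  here : col x ≡ c → Conn G col c x x
  step : ∀ {y z} → Conn G col c x y → Adj G y z → col z ≡ c → Conn G col c x z

Move : (G : Graph) → Coloring G → Coloring G → Set
Move G col col' =
  Σ[ v ∈ Fin (n G) ] Σ[ c' ∈ ℕ ]
    (c' ≢ col v)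
  × (Σ[ w ∈ Fin (n G) ] (Adj G v w × col w ≡ c'))
  × (∀ x → (Conn G col (col v) v x → col' x ≡ c')
         × (¬ Conn G col (col v) v x → col' x ≡ col x))

-- The game always terminates (each move strictly decreases the number of
-- monochromatic components), so this inductive characterisation is the
-- usual notion of P-position (Sprague–Grundy value 0).
mutual
  data Lose (G : Graph) (col : Coloring G) : Set where
    lose : (∀ col' → Move G col col' → Win G col') → Lose G col

  data Win (G : Graph) (col : Coloring G) : Set where
    win : (col' : Coloring G) → Move G col col' → Lose G col' → Win G col

record Position : Set where
  constructor pos
  field
    graph : Graph
    color : Coloring graph

IsP : Position → Set
IsP (pos G col) = Lose G col

-- Vertex labels: 0 = u, (1 = v if u ≠ v), then
-- internal vertices of the paths get consecutive fresh labels.  The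
-- proper 2-coloring gives the vertex at distance t from u along a path
-- the color t % 2; u has color 0.

-- internal vertices of a path: previous vertex `prev`, position t of the
-- next internal vertex, number of internal vertices still to create,
-- endpoint v, next fresh label f.
chain : (prev t cnt v f : ℕ) → List (ℕ × ℕ) × List ℕ
chain prev t zero      v f = ((prev , v) ∷ []) , []
chain prev t (suc cnt) v f with chain f (suc t) cnt v (suc f)
... | es , cs = ((prev , f) ∷ es) , ((t % 2) ∷ cs)

path : (u v L f : ℕ) → List (ℕ × ℕ) × List ℕ
path u v zero          f = [] , []
path u v (suc zero)    f = ((u , v) ∷ []) , []
path u v (suc (suc m)) f = chain u 1 (suc m) v f

paths : (u v : ℕ) → List ℕ → (f : ℕ) → List (ℕ × ℕ) × List ℕ
paths u v []       f = [] , []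
paths u v (L ∷ Ls) f with path u v L f
... | es , cs with paths u v Ls (f + length cs)
...   | es' , cs' = (es ++ es') , (cs ++ cs')

mkPos : List ℕ → List (ℕ × ℕ) → Position
mkPos cols es = pos (record { n = length cols ; edges = es }) (lookup cols)

-- u ≠ v joined by paths of the given lengths (all of parity p); u has
-- color 0 and v has color p.
theta : (p : ℕ) → List ℕ → Position
theta p Ls with paths 0 1 Ls 2
... | es , cs = mkPos (0 ∷ p ∷ cs) es

-- u = v with the given closed paths (length 2 = pendant vertex,
-- length 4 / 6 = cycles of length 4 / 6 through u).
loopG : List ℕ → Position
loopG Ls with paths 0 0 Ls 1
... | es , cs = mkPos (0 ∷ cs) es

P246 : ℕ → ℕ → ℕ → Position
P246 i j k = theta 0 (replicate i 2 ++ replicate j 4 ++ replicate k 6)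

P0246 : ℕ → ℕ → ℕ → Position
P0246 i j k = loopG (replicate i 2 ++ replicate j 4 ++ replicate k 6)

P35 : ℕ → ℕ → Position
P35 i j = theta 1 (replicate i 3 ++ replicate j 5)

P135 : ℕ → ℕ → Position
P135 i j = theta 1 (1 ∷ replicate i 3 ++ replicate j 5)

-- Colour the graph properly and let d q be the number of colour changes along path q.  A move
-- recolours a monochromatic component K of a 2-colouring, which removes exactly the colour changes on
-- the edges leaving K.  Hence a move inside a path lowers that d q by 2, and a move at the hub lowers
-- every d q by 1 when u ≠ v are joined by no monochromatic path, and by 2 (truncated at 0) otherwise;
-- conversely each such effect is achieved by a move.  The game is thus the abstract game on the
-- numbers of paths with 2, 4, 6 (or 1, 3, 5) colour changes.  Its P-positions depend only on the
-- classes 0, 1, 2, odd ≥ 3, even ≥ 4 of these numbers, the resulting finite table is checked by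
-- evaluation, and induction on the total number of colour changes transfers it to the game.

module Submission where

open import Defs
open import Data.Bool using (Bool; true; false; _∧_; _∨_; not; _xor_; if_then_else_)
open import Data.Bool.Properties using (T-≡; ¬-not; ∧-conicalˡ; ∧-conicalʳ; ∧-zeroʳ; ∨-zeroʳ; ∨-identityʳ)
open import Data.Empty using (⊥-elim)
open import Data.Fin using (Fin; toℕ; fromℕ<) renaming (zero to fzero; suc to fsuc)
open import Data.Fin.Properties using (toℕ<n; toℕ-fromℕ<; fromℕ<-toℕ; toℕ-injective; any?) renaming (_≟_ to _≟ᶠ_; suc-injective to fsuc-injective)
open import Data.List using (List; []; _∷_; _++_; length; lookup; replicate)
open import Data.List.Properties using (length-++)
open import Data.List.Membership.Propositional using (_∈_)
open import Data.List.Membership.Propositional.Properties using (∈-++⁻; ∈-++⁺ˡ; ∈-++⁺ʳ; ∈-lookup)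
open import Data.List.Relation.Unary.All using (All)
import Data.List.Relation.Unary.All as All
open import Data.List.Relation.Unary.All.Properties using (++⁺; replicate⁺)
open import Data.List.Relation.Unary.Any using (here; there)
open import Data.Nat using (ℕ; zero; suc; _+_; _*_; _∸_; _≤_; _<_; z≤n; s≤s; _%_; _≡ᵇ_; _<ᵇ_; _≟_; _<?_)
open import Data.Nat.DivMod using (m%n<n; [m+n]%n≡m%n)
open import Data.Nat.Induction using (<-wellFounded)
open import Data.Nat.Properties
open import Algebra.Properties.CommutativeSemigroup +-commutativeSemigroup using (interchange)
open import Data.Nat.Tactic.RingSolver using (solve-∀)
open import Data.Product using (Σ-syntax; _×_; _,_; proj₁; proj₂; map₂; uncurry)
open import Data.Product.Properties using (,-injective)
open import Data.Sum using (_⊎_; inj₁; inj₂) renaming (map₂ to ⊎-map₂)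
open import Function using (_∘_; Equivalence)
open import Induction.WellFounded using (Acc; acc)
open import Relation.Binary using (tri<; tri≈; tri>)
open import Relation.Binary.PropositionalEquality using (_≡_; _≢_; refl; sym; trans; cong; cong₂; subst; subst₂; module ≡-Reasoning)
open import Relation.Nullary using (¬_; Dec; yes; no)

open ≡-Reasoning

≡ᵇ-refl : ∀ n → (n ≡ᵇ n) ≡ true
≡ᵇ-refl n = Equivalence.to T-≡ (≡⇒≡ᵇ n n refl)

≡ᵇ-true⁻¹ : ∀ {m n} → (m ≡ᵇ n) ≡ true → m ≡ n
≡ᵇ-true⁻¹ {m} {n} e = ≡ᵇ⇒≡ m n (Equivalence.from T-≡ e)

≡ᵇ-false : ∀ {m n} → m ≢ n → (m ≡ᵇ n) ≡ false
≡ᵇ-false m≢n = ¬-not (m≢n ∘ ≡ᵇ-true⁻¹)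

<ᵇ-true : ∀ {m n} → m < n → (m <ᵇ n) ≡ true
<ᵇ-true m<n = Equivalence.to T-≡ (<⇒<ᵇ m<n)

<ᵇ-true⁻¹ : ∀ {m n} → (m <ᵇ n) ≡ true → m < n
<ᵇ-true⁻¹ {m} {n} e = <ᵇ⇒< m n (Equivalence.from T-≡ e)

<ᵇ-false : ∀ {m n} → n ≤ m → (m <ᵇ n) ≡ false
<ᵇ-false n≤m = ¬-not (≤⇒≯ n≤m ∘ <ᵇ-true⁻¹)

true≢false : true ≡ false → ∀ {A : Set} → A
true≢false ()

∨-true⁻¹ : ∀ x {y} → x ∨ y ≡ true → x ≡ true ⊎ y ≡ true
∨-true⁻¹ true  _ = inj₁ refl
∨-true⁻¹ false h = inj₂ h

∧-true : ∀ {x y} → x ≡ true → y ≡ true → x ∧ y ≡ true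
∧-true refl refl = refl

%2-suc-suc : ∀ k → suc (suc k) % 2 ≡ k % 2
%2-suc-suc k = trans (cong (_% 2) (+-comm 2 k)) ([m+n]%n≡m%n k 2)

∑ : (ℕ → ℕ) → ℕ → ℕ
∑ f zero    = 0
∑ f (suc L) = ∑ f L + f L

∑-cong : ∀ {f g} L → (∀ t → t < L → f t ≡ g t) → ∑ f L ≡ ∑ g L
∑-cong zero    _ = refl
∑-cong (suc L) h = cong₂ _+_ (∑-cong L (λ t t<L → h t (m<n⇒m<1+n t<L))) (h L ≤-refl)

∑-+ : ∀ f g L → ∑ (λ t → f t + g t) L ≡ ∑ f L + ∑ g L
∑-+ f g zero    = refl
∑-+ f g (suc L) = trans (cong (_+ (f L + g L)) (∑-+ f g L)) (interchange (∑ f L) (∑ g L) (f L) (g L))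

∑-0 : ∀ L → ∑ (λ _ → 0) L ≡ 0
∑-0 zero    = refl
∑-0 (suc L) = cong (_+ 0) (∑-0 L)

δ : ℕ → ℕ → ℕ
δ p t = if t ≡ᵇ p then 1 else 0

δ-refl : ∀ p → δ p p ≡ 1
δ-refl p = cong (if_then 1 else 0) (≡ᵇ-refl p)

δ-≢ : ∀ {p t} → t ≢ p → δ p t ≡ 0
δ-≢ t≢p = cong (if_then 1 else 0) (≡ᵇ-false t≢p)

∑-δ-≤ : ∀ p L → L ≤ p → ∑ (δ p) L ≡ 0
∑-δ-≤ p zero    _   = refl
∑-δ-≤ p (suc L) L<p = cong₂ _+_ (∑-δ-≤ p L (<⇒≤ L<p)) (δ-≢ (<⇒≢ L<p))

∑-δ : ∀ p L → p < L → ∑ (δ p) L ≡ 1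
∑-δ p (suc L) p<1+L with m≤n⇒m<n∨m≡n (≤-pred p<1+L)
... | inj₁ p<L  = cong₂ _+_ (∑-δ p L p<L) (δ-≢ (λ L≡p → <-irrefl (sym L≡p) p<L))
... | inj₂ refl = cong₂ _+_ (∑-δ-≤ p p ≤-refl) (δ-refl p)

change : ℕ → ℕ → ℕ
change a b = if a ≡ᵇ b then 0 else 1

change-refl : ∀ a → change a a ≡ 0
change-refl a = cong (if_then 0 else 1) (≡ᵇ-refl a)

change-≢ : ∀ {a b} → a ≢ b → change a b ≡ 1
change-≢ a≢b = cong (if_then 0 else 1) (≡ᵇ-false a≢b)

change≡0⇒≡ : ∀ a b → change a b ≡ 0 → a ≡ b
change≡0⇒≡ a b h with a ≡ᵇ b in eq
... | true = ≡ᵇ-true⁻¹ eq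

changes : (ℕ → ℕ) → ℕ → ℕ
changes w L = ∑ (λ t → change (w t) (w (suc t))) L

changes-cong : ∀ {w w′} L → (∀ t → t ≤ L → w t ≡ w′ t) → changes w L ≡ changes w′ L
changes-cong L h = ∑-cong L (λ t t<L → cong₂ change (h t (<⇒≤ t<L)) (h (suc t) t<L))

changes-const : ∀ {w c} L → (∀ t → t ≤ L → w t ≡ c) → changes w L ≡ 0
changes-const {c = c} L h = trans (changes-cong L h) (trans (∑-cong L (λ _ _ → change-refl c)) (∑-0 L))

changes≡0⇒const : ∀ w L → changes w L ≡ 0 → ∀ t → t ≤ L → w t ≡ w 0
changes≡0⇒const w zero    _ t t≤0 rewrite n≤0⇒n≡0 t≤0 = refl
changes≡0⇒const w (suc L) h t t≤1+L with m≤n⇒m<n∨m≡n t≤1+L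
... | inj₁ t<1+L = changes≡0⇒const w L (m+n≡0⇒m≡0 _ h) t (≤-pred t<1+L)
... | inj₂ refl  = trans (sym (change≡0⇒≡ _ _ (m+n≡0⇒n≡0 (changes w L) h)))
                         (changes≡0⇒const w L (m+n≡0⇒m≡0 _ h) L ≤-refl)

changes-alternating : ∀ w L → (∀ t → t < L → w t ≢ w (suc t)) → changes w L ≡ L
changes-alternating w zero    _ = refl
changes-alternating w (suc L) h =
  trans (cong₂ _+_ (changes-alternating w L (λ t t<L → h t (m<n⇒m<1+n t<L))) (change-≢ (h L ≤-refl)))
        (+-comm L 1)

changes-single-switch : ∀ w L e {c₀ c} → e < L → c₀ ≢ c →
  (∀ t → t ≤ e → w t ≡ c₀) → (∀ t → e < t → t ≤ L → w t ≡ c) → changes w L ≡ 1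
changes-single-switch w L e {c₀} {c} e<L c₀≢c before after = trans (∑-cong L at) (∑-δ e L e<L)
  where
  at : ∀ t → t < L → change (w t) (w (suc t)) ≡ δ e t
  at t t<L with <-cmp t e
  ... | tri< t<e _ _ rewrite before t (<⇒≤ t<e) | before (suc t) t<e = trans (change-refl c₀) (sym (δ-≢ (<⇒≢ t<e)))
  ... | tri≈ _ refl _ rewrite before t ≤-refl | after (suc t) ≤-refl t<L = trans (change-≢ c₀≢c) (sym (δ-refl t))
  ... | tri> _ _ e<t rewrite after t e<t (<⇒≤ t<L) | after (suc t) (m<n⇒m<1+n e<t) t<L =
    trans (change-refl c) (sym (δ-≢ (λ t≡e → <-irrefl (sym t≡e) e<t)))

cut : Bool → Bool → ℕ
cut x y = if x xor y then 1 else 0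

cuts : (ℕ → Bool) → ℕ → ℕ
cuts J L = ∑ (λ t → cut (J t) (J (suc t))) L

cuts-const : ∀ J L j → (∀ t → t ≤ L → J t ≡ j) → cuts J L ≡ 0
cuts-const J L j h = trans (∑-cong L same) (∑-0 L)
  where
  cut-diag : ∀ j → cut j j ≡ 0
  cut-diag true  = refl
  cut-diag false = refl
  same : ∀ t → t < L → cut (J t) (J (suc t)) ≡ 0
  same t t<L rewrite h t (<⇒≤ t<L) | h (suc t) t<L = cut-diag j

cuts-δ : ∀ J L p → p < L → (∀ t → t < L → cut (J t) (J (suc t)) ≡ δ p t) → cuts J L ≡ 1
cuts-δ J L p p<L h = trans (∑-cong L h) (∑-δ p L p<L)

cuts-δ+δ : ∀ J L p p′ → p < L → p′ < L →
  (∀ t → t < L → cut (J t) (J (suc t)) ≡ δ p t + δ p′ t) → cuts J L ≡ 2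
cuts-δ+δ J L p p′ p<L p′<L h =
  trans (∑-cong L h) (trans (∑-+ (δ p) (δ p′) L) (cong₂ _+_ (∑-δ p L p<L) (∑-δ p′ L p′<L)))

cut-prefix : ∀ e t → cut (t <ᵇ suc e) (suc t <ᵇ suc e) ≡ δ e t
cut-prefix zero    zero    = refl
cut-prefix (suc e) zero    = refl
cut-prefix zero    (suc t) = refl
cut-prefix (suc e) (suc t) = cut-prefix e t

cut-suffix : ∀ g t → cut (g <ᵇ t) (g <ᵇ suc t) ≡ δ g t
cut-suffix zero    zero    = refl
cut-suffix zero    (suc t) = refl
cut-suffix (suc g) zero    = refl
cut-suffix (suc g) (suc t) = cut-suffix g t

cut-interval : ∀ a b t → a < b →
  cut ((a <ᵇ t) ∧ (t <ᵇ suc b)) ((a <ᵇ suc t) ∧ (suc t <ᵇ suc b)) ≡ δ a t + δ b t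
cut-interval zero    (suc b) zero    _ = refl
cut-interval zero    (suc b) (suc t) _ = cut-prefix (suc b) (suc t)
cut-interval (suc a) (suc b) zero    _ = refl
cut-interval (suc a) (suc b) (suc t) (s≤s a<b) = cut-interval a b t a<b

cut-prefix∪suffix : ∀ e g t → e < g →
  cut ((t <ᵇ suc e) ∨ (g <ᵇ t)) ((suc t <ᵇ suc e) ∨ (g <ᵇ suc t)) ≡ δ e t + δ g t
cut-prefix∪suffix zero    (suc g) zero    _ = refl
cut-prefix∪suffix zero    (suc g) (suc t) _ = cut-suffix (suc g) (suc t)
cut-prefix∪suffix (suc e) (suc g) zero    _ = refl
cut-prefix∪suffix (suc e) (suc g) (suc t) (s≤s e<g) = cut-prefix∪suffix e g t e<g

Recoloured : ℕ → ℕ → Bool → ℕ → ℕ → Set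
Recoloured c c′ j a a′ = (j ≡ true → a ≡ c × a′ ≡ c′) × (j ≡ false → a′ ≡ a)

change-recolour : ∀ {c c′ a b a′ b′} ja jb → c ≢ c′ →
  Recoloured c c′ ja a a′ → Recoloured c c′ jb b b′ →
  (ja ≡ true → jb ≡ false → b ≡ c′) → (jb ≡ true → ja ≡ false → a ≡ c′) →
  change a′ b′ + cut ja jb ≡ change a b
change-recolour {c} {c′} true true _ (ra , _) (rb , _) _ _ with ra refl | rb refl
... | refl , refl | refl , refl rewrite change-refl c′ = sym (change-refl c)
change-recolour {c′ = c′} true false c≢c′ (ra , _) (_ , rb) out _ with ra refl | rb refl | out refl refl
... | refl , refl | refl | refl rewrite change-refl c′ = sym (change-≢ c≢c′)
change-recolour {c′ = c′} false true c≢c′ (_ , ra) (rb , _) _ out with rb refl | ra refl | out refl refl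
... | refl , refl | refl | refl rewrite change-refl c′ = sym (change-≢ (λ e → c≢c′ (sym e)))
change-recolour false false _ (_ , ra) (_ , rb) _ _ rewrite ra refl | rb refl = +-identityʳ _

changes-recolour : ∀ L (w w′ : ℕ → ℕ) (J : ℕ → Bool) →
  (∀ t → t < L → change (w′ t) (w′ (suc t)) + cut (J t) (J (suc t)) ≡ change (w t) (w (suc t))) →
  changes w′ L + cuts J L ≡ changes w L
changes-recolour L w w′ J h = trans (sym (∑-+ _ _ L)) (∑-cong L h)

-- Maximal monochromatic runs: runEnd c w s k is the last position of the c-run of w starting at s
-- (looking at most k positions ahead), runStart c w s the first position of the c-run ending at s.

runEnd : ℕ → (ℕ → ℕ) → ℕ → ℕ → ℕ
runEnd c w s zero    = s
runEnd c w s (suc k) with w (suc s) ≟ c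
... | yes _ = runEnd c w (suc s) k
... | no  _ = s

s≤runEnd : ∀ c w s k → s ≤ runEnd c w s k
s≤runEnd c w s zero    = ≤-refl
s≤runEnd c w s (suc k) with w (suc s) ≟ c
... | yes _ = ≤-trans (n≤1+n s) (s≤runEnd c w (suc s) k)
... | no  _ = ≤-refl

runEnd≤ : ∀ c w s k → runEnd c w s k ≤ s + k
runEnd≤ c w s zero    = ≤-reflexive (sym (+-identityʳ s))
runEnd≤ c w s (suc k) with w (suc s) ≟ c
... | yes _ = ≤-trans (runEnd≤ c w (suc s) k) (≤-reflexive (sym (+-suc s k)))
... | no  _ = m≤m+n s (suc k)

runEnd-const : ∀ c w s k → w s ≡ c → ∀ t → s ≤ t → t ≤ runEnd c w s k → w t ≡ c
runEnd-const c w s zero    ws t s≤t t≤e = subst (λ z → w z ≡ c) (≤-antisym s≤t t≤e) ws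
runEnd-const c w s (suc k) ws t s≤t t≤e with w (suc s) ≟ c
... | no  _ = subst (λ z → w z ≡ c) (≤-antisym s≤t t≤e) ws
... | yes w1+s with m≤n⇒m<n∨m≡n s≤t
...   | inj₁ s<t  = runEnd-const c w (suc s) k w1+s t s<t t≤e
...   | inj₂ refl = ws

runEnd-stops : ∀ c w s k → runEnd c w s k < s + k → w (suc (runEnd c w s k)) ≢ c
runEnd-stops c w s zero    e<s+0 = ⊥-elim (<-irrefl (sym (+-identityʳ s)) e<s+0)
runEnd-stops c w s (suc k) e<s+k with w (suc s) ≟ c
... | yes _   = runEnd-stops c w (suc s) k (≤-trans e<s+k (≤-reflexive (+-suc s k)))
... | no  w≢c = w≢c

runEnd-maximal : ∀ c w s k j → (∀ t → s ≤ t → t ≤ s + j → w t ≡ c) → j ≤ k → s + j ≤ runEnd c w s k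
runEnd-maximal c w s k       zero    _ _ = subst (_≤ runEnd c w s k) (sym (+-identityʳ s)) (s≤runEnd c w s k)
runEnd-maximal c w s (suc k) (suc j) h (s≤s j≤k) with w (suc s) ≟ c
... | yes _ = subst (_≤ runEnd c w (suc s) k) (sym (+-suc s j))
                (runEnd-maximal c w (suc s) k j
                  (λ t s<t t≤ → h t (<⇒≤ s<t) (≤-trans t≤ (≤-reflexive (sym (+-suc s j))))) j≤k)
... | no  w≢c = ⊥-elim (w≢c (h (suc s) (n≤1+n s) (≤-trans (s≤s (m≤m+n s j)) (≤-reflexive (sym (+-suc s j))))))

runStart : ℕ → (ℕ → ℕ) → ℕ → ℕ
runStart c w zero    = zero
runStart c w (suc s) with w s ≟ c
... | yes _ = runStart c w s
... | no  _ = suc s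

runStart≤ : ∀ c w s → runStart c w s ≤ s
runStart≤ c w zero    = z≤n
runStart≤ c w (suc s) with w s ≟ c
... | yes _ = ≤-trans (runStart≤ c w s) (n≤1+n s)
... | no  _ = ≤-refl

runStart-const : ∀ c w s → w s ≡ c → ∀ t → runStart c w s ≤ t → t ≤ s → w t ≡ c
runStart-const c w zero    ws t _ t≤0 = subst (λ z → w z ≡ c) (sym (n≤0⇒n≡0 t≤0)) ws
runStart-const c w (suc s) ws t b≤t t≤s with w s ≟ c
... | no  _ = subst (λ z → w z ≡ c) (≤-antisym b≤t t≤s) ws
... | yes w≡c with m≤n⇒m<n∨m≡n t≤s
...   | inj₁ t<1+s = runStart-const c w s w≡c t b≤t (≤-pred t<1+s)
...   | inj₂ refl  = ws

runStart-stops : ∀ c w s g → runStart c w s ≡ suc g → w g ≢ c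
runStart-stops c w zero    g ()
runStart-stops c w (suc s) g b≡1+g with w s ≟ c
... | yes _ = runStart-stops c w s g b≡1+g
runStart-stops c w (suc s) g refl | no w≢c = w≢c

runStart-minimal : ∀ c w s j → (∀ t → j ≤ t → t ≤ s → w t ≡ c) → j ≤ s → runStart c w s ≤ j
runStart-minimal c w zero    j _ _ = z≤n
runStart-minimal c w (suc s) j h j≤1+s with m≤n⇒m<n∨m≡n j≤1+s
... | inj₂ refl = runStart≤ c w (suc s)
... | inj₁ j<1+s with w s ≟ c
...   | yes _   = runStart-minimal c w s j (λ t j≤t t≤s → h t j≤t (m≤n⇒m≤1+n t≤s)) (≤-pred j<1+s)
...   | no  w≢c = ⊥-elim (w≢c (h s (≤-pred j<1+s) (n≤1+n s)))

runStart-after-switch : ∀ c w e → w e ≢ c → runStart c w (suc e) ≡ suc e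
runStart-after-switch c w e w≢c with w e ≟ c
... | yes w≡c = ⊥-elim (w≢c w≡c)
... | no  _   = refl

runEnd-reaches : ∀ c w s L → s ≤ L → w s ≡ c → ¬ runEnd c w s (L ∸ s) < L → ∀ t → s ≤ t → t ≤ L → w t ≡ c
runEnd-reaches c w s L s≤L ws end≮ t s≤t t≤L = runEnd-const c w s (L ∸ s) ws t s≤t (subst (t ≤_) (sym end≡) t≤L)
  where
  end≡ : runEnd c w s (L ∸ s) ≡ L
  end≡ = ≤-antisym (subst (runEnd c w s (L ∸ s) ≤_) (m+[n∸m]≡n s≤L) (runEnd≤ c w s (L ∸ s))) (≮⇒≥ end≮)

data Class : Set where
  k0 k1 k2 kOdd kEven : Class

sucᶜ : Class → Class
sucᶜ k0    = k1
sucᶜ k1    = k2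
sucᶜ k2    = kOdd
sucᶜ kOdd  = kEven
sucᶜ kEven = kOdd

-- n ↦ 0, 1, 2, odd ≥ 3, even ≥ 4.
class : ℕ → Class
class zero    = k0
class (suc n) = sucᶜ (class n)

is0 is1 isEven isOdd≥3 : Class → Bool
is0 k0 = true
is0 _  = false
is1 k1 = true
is1 _  = false
isEven k0    = true
isEven k2    = true
isEven kEven = true
isEven _     = false
isOdd≥3 kOdd = true
isOdd≥3 _    = false

is0-sucᶜ : ∀ x → is0 (sucᶜ x) ≡ false
is0-sucᶜ k0    = refl
is0-sucᶜ k1    = refl
is0-sucᶜ k2    = refl
is0-sucᶜ kOdd  = refl
is0-sucᶜ kEven = refl

allᶜ : (Class → Bool) → Bool
allᶜ f = f k0 ∧ f k1 ∧ f k2 ∧ f kOdd ∧ f kEven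

allᶜ-sound : ∀ f → allᶜ f ≡ true → ∀ x → f x ≡ true
allᶜ-sound f h k0    = ∧-conicalˡ _ _ h
allᶜ-sound f h k1    = ∧-conicalˡ _ _ (∧-conicalʳ (f k0) _ h)
allᶜ-sound f h k2    = ∧-conicalˡ _ _ (∧-conicalʳ (f k1) _ (∧-conicalʳ (f k0) _ h))
allᶜ-sound f h kOdd  = ∧-conicalˡ _ _ (∧-conicalʳ (f k2) _ (∧-conicalʳ (f k1) _ (∧-conicalʳ (f k0) _ h)))
allᶜ-sound f h kEven = ∧-conicalʳ (f kOdd) _ (∧-conicalʳ (f k2) _ (∧-conicalʳ (f k1) _ (∧-conicalʳ (f k0) _ h)))

Class³ : Set
Class³ = Class → Class → Class → Bool

all³ : Class³ → Bool
all³ f = allᶜ (λ x → allᶜ (λ y → allᶜ (f x y)))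

all³-sound : ∀ f → all³ f ≡ true → ∀ x y z → f x y z ≡ true
all³-sound f h x y z =
  allᶜ-sound (f x y) (allᶜ-sound (λ y → allᶜ (f x y)) (allᶜ-sound (λ x → allᶜ (λ y → allᶜ (f x y))) h x) y) z

disjoint-by-computation : ∀ (f g : Class³) → all³ (λ x y z → not (f x y z ∧ g x y z)) ≡ true →
  ∀ x y z → f x y z ≡ true → g x y z ≡ false
disjoint-by-computation f g h x y z fxyz with f x y z | g x y z | all³-sound (λ x y z → not (f x y z ∧ g x y z)) h x y z
... | _    | false | _ = refl
... | true | true  | ()

-- loop: u and v are fused (u = v, or some path is monochromatic); evenθ, oddθ: u ≠ v and all paths
-- have even, resp. odd, length.
data Shape : Set where
  loop evenθ oddθ : Shape

P-loop P-even P-odd : Class³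
P-loop a b k0 = is0 a ∨ (isEven a ∧ not (is0 b))
P-loop a b k1 = not (isEven a) ∧ not (isEven b)
P-loop a b _  = isEven a ∧ not (isEven b)
P-even a b k0 = (is0 a ∧ not (is1 b)) ∨ (not (is0 a) ∧ isEven a ∧ isEven b) ∨ (isOdd≥3 a ∧ is0 b)
P-even a b k1 = (is0 a ∧ is0 b) ∨ (not (is0 a) ∧ isEven b)
P-even a b _  = isEven b
P-odd k0 b k0 = is0 b ∨ is1 b
P-odd _  b _  = not (isEven b)

P-table : Shape → Class³
P-table loop  = P-loop
P-table evenθ = P-even
P-table oddθ  = P-odd

-- Abstract positions: the counts a b c of paths with 2, 4, 6 colour changes (loop, evenθ) or with
-- 1, 3, 5 colour changes (oddθ).  A move inside a path removes two changes from that path; a move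
-- at the hub removes one change from every path of a θ-graph and two from every path of a loop.
data AState : Set where
  st : Shape → ℕ → ℕ → ℕ → AState

P-state : AState → Bool
P-state (st s a b c) = P-table s (class a) (class b) (class c)

data NotAllZero : ℕ → ℕ → ℕ → Set where
  nz₁ : ∀ {a b c} → NotAllZero (suc a) b c
  nz₂ : ∀ {a b c} → NotAllZero a (suc b) c
  nz₃ : ∀ {a b c} → NotAllZero a b (suc c)

data AMove : AState → AState → Set where
  loop-hub  : ∀ {a b c} → NotAllZero a b c → AMove (st loop a b c) (st loop b c 0)
  loop-a    : ∀ {a b c} → AMove (st loop (suc a) b c) (st loop a b c)
  loop-b    : ∀ {a b c} → AMove (st loop a (suc b) c) (st loop (suc a) b c)
  loop-c    : ∀ {a b c} → AMove (st loop a b (suc c)) (st loop a (suc b) c)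
  even-hub  : ∀ {a b c} → NotAllZero a b c → AMove (st evenθ a b c) (st oddθ a b c)
  even-a    : ∀ {a b c} → AMove (st evenθ (suc a) b c) (st loop a b c)
  even-b    : ∀ {a b c} → AMove (st evenθ a (suc b) c) (st evenθ (suc a) b c)
  even-c    : ∀ {a b c} → AMove (st evenθ a b (suc c)) (st evenθ a (suc b) c)
  odd-hub₀  : ∀ {b c} → NotAllZero 0 b c → AMove (st oddθ 0 b c) (st evenθ b c 0)
  odd-hub₁  : ∀ {a b c} → AMove (st oddθ (suc a) b c) (st loop b c 0)
  odd-b     : ∀ {a b c} → AMove (st oddθ a (suc b) c) (st oddθ (suc a) b c)
  odd-c     : ∀ {a b c} → AMove (st oddθ a b (suc c)) (st oddθ a (suc b) c)

notAllZeroᶜ : Class³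
notAllZeroᶜ a b c = not (is0 a ∧ is0 b ∧ is0 c)

notAllZero-class : ∀ {a b c} → NotAllZero a b c → notAllZeroᶜ (class a) (class b) (class c) ≡ true
notAllZero-class {suc a} nz₁ rewrite is0-sucᶜ (class a) = refl
notAllZero-class {a} {suc b} nz₂ rewrite is0-sucᶜ (class b) | ∧-zeroʳ (is0 (class a)) = refl
notAllZero-class {a} {b} {suc c} nz₃
  rewrite is0-sucᶜ (class c) | ∧-zeroʳ (is0 (class b)) | ∧-zeroʳ (is0 (class a)) = refl

notAllZero⁻¹ : ∀ a b c → notAllZeroᶜ (class a) (class b) (class c) ≡ true → NotAllZero a b c
notAllZero⁻¹ (suc a) b       c       _ = nz₁
notAllZero⁻¹ zero    (suc b) c       _ = nz₂
notAllZero⁻¹ zero    zero    (suc c) _ = nz₃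

nz₁′ : ∀ {a b c} → Σ[ n ∈ ℕ ] a ≡ suc n → NotAllZero a b c
nz₁′ (_ , refl) = nz₁

nz₂′ : ∀ {a b c} → Σ[ n ∈ ℕ ] b ≡ suc n → NotAllZero a b c
nz₂′ (_ , refl) = nz₂

nz₃′ : ∀ {a b c} → Σ[ n ∈ ℕ ] c ≡ suc n → NotAllZero a b c
nz₃′ (_ , refl) = nz₃

P⇒moves-to-N : ∀ {s s′} → P-state s ≡ true → AMove s s′ → P-state s′ ≡ false
P⇒moves-to-N {st _ a b c} P (loop-hub nz) =
  disjoint-by-computation (λ a b c → notAllZeroᶜ a b c ∧ P-loop a b c) (λ a b c → P-loop b c k0) refl
    (class a) (class b) (class c) (∧-true (notAllZero-class nz) P)
P⇒moves-to-N {st _ (suc a) b c} P loop-a =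
  disjoint-by-computation (λ a b c → P-loop (sucᶜ a) b c) P-loop refl (class a) (class b) (class c) P
P⇒moves-to-N {st _ a (suc b) c} P loop-b =
  disjoint-by-computation (λ a b c → P-loop a (sucᶜ b) c) (λ a b c → P-loop (sucᶜ a) b c) refl
    (class a) (class b) (class c) P
P⇒moves-to-N {st _ a b (suc c)} P loop-c =
  disjoint-by-computation (λ a b c → P-loop a b (sucᶜ c)) (λ a b c → P-loop a (sucᶜ b) c) refl
    (class a) (class b) (class c) P
P⇒moves-to-N {st _ a b c} P (even-hub nz) =
  disjoint-by-computation (λ a b c → notAllZeroᶜ a b c ∧ P-even a b c) P-odd refl
    (class a) (class b) (class c) (∧-true (notAllZero-class nz) P)
P⇒moves-to-N {st _ (suc a) b c} P even-a =
  disjoint-by-computation (λ a b c → P-even (sucᶜ a) b c) P-loop refl (class a) (class b) (class c) P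
P⇒moves-to-N {st _ a (suc b) c} P even-b =
  disjoint-by-computation (λ a b c → P-even a (sucᶜ b) c) (λ a b c → P-even (sucᶜ a) b c) refl
    (class a) (class b) (class c) P
P⇒moves-to-N {st _ a b (suc c)} P even-c =
  disjoint-by-computation (λ a b c → P-even a b (sucᶜ c)) (λ a b c → P-even a (sucᶜ b) c) refl
    (class a) (class b) (class c) P
P⇒moves-to-N {st _ _ b c} P (odd-hub₀ nz) =
  disjoint-by-computation (λ a b c → notAllZeroᶜ k0 b c ∧ P-odd k0 b c) (λ a b c → P-even b c k0) refl
    k0 (class b) (class c) (∧-true (notAllZero-class nz) P)
P⇒moves-to-N {st _ (suc a) b c} P odd-hub₁ =
  disjoint-by-computation (λ a b c → P-odd (sucᶜ a) b c) (λ a b c → P-loop b c k0) refl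
    (class a) (class b) (class c) P
P⇒moves-to-N {st _ a (suc b) c} P odd-b =
  disjoint-by-computation (λ a b c → P-odd a (sucᶜ b) c) (λ a b c → P-odd (sucᶜ a) b c) refl
    (class a) (class b) (class c) P
P⇒moves-to-N {st _ a b (suc c)} P odd-c =
  disjoint-by-computation (λ a b c → P-odd a b (sucᶜ c)) (λ a b c → P-odd a (sucᶜ b) c) refl
    (class a) (class b) (class c) P

-- predecessors g x: g holds for every class whose successor is x (and there is one).
predecessors : (Class → Bool) → Class → Bool
predecessors g k0    = false
predecessors g k1    = g k0
predecessors g k2    = g k1
predecessors g kOdd  = g k2 ∧ g kEven
predecessors g kEven = g kOdd

predecessors-sucᶜ : ∀ g x → predecessors g (sucᶜ x) ≡ true → g x ≡ true
predecessors-sucᶜ g k0    h = h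
predecessors-sucᶜ g k1    h = h
predecessors-sucᶜ g k2    h = ∧-conicalˡ _ _ h
predecessors-sucᶜ g kOdd  h = h
predecessors-sucᶜ g kEven h = ∧-conicalʳ (g k2) _ h

predecessors-sound : ∀ g n → predecessors g (class n) ≡ true → Σ[ m ∈ ℕ ] n ≡ suc m × g (class m) ≡ true
predecessors-sound g (suc n) h = n , refl , predecessors-sucᶜ g (class n) h

HasMoveToP : AState → Set
HasMoveToP s = Σ[ s′ ∈ AState ] AMove s s′ × P-state s′ ≡ true

P-or-move-to-P-loop : Class³
P-or-move-to-P-loop a b c =
  P-loop a b c ∨ (notAllZeroᶜ a b c ∧ P-loop b c k0) ∨ predecessors (λ t → P-loop t b c) a
  ∨ predecessors (λ t → P-loop (sucᶜ a) t c) b ∨ predecessors (λ t → P-loop a (sucᶜ b) t) c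

N-loop-has-move-to-P : ∀ a b c → P-loop (class a) (class b) (class c) ≡ false → HasMoveToP (st loop a b c)
N-loop-has-move-to-P a b c N
  with ∨-true⁻¹ _ (all³-sound P-or-move-to-P-loop refl (class a) (class b) (class c))
... | inj₁ P = true≢false (trans (sym P) N)
... | inj₂ h with ∨-true⁻¹ _ h
... | inj₁ hub = _ , loop-hub (notAllZero⁻¹ a b c (∧-conicalˡ _ _ hub)) , ∧-conicalʳ _ _ hub
... | inj₂ h with ∨-true⁻¹ _ h
... | inj₁ ha with predecessors-sound _ a ha
...   | _ , refl , P = _ , loop-a , P
N-loop-has-move-to-P a b c N | inj₂ _ | inj₂ _ | inj₂ h with ∨-true⁻¹ _ h
... | inj₁ hb with predecessors-sound _ b hb
...   | _ , refl , P = _ , loop-b , P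
N-loop-has-move-to-P a b c N | inj₂ _ | inj₂ _ | inj₂ _ | inj₂ hc with predecessors-sound _ c hc
...   | _ , refl , P = _ , loop-c , P

P-or-move-to-P-even : Class³
P-or-move-to-P-even a b c =
  P-even a b c ∨ (notAllZeroᶜ a b c ∧ P-odd a b c) ∨ predecessors (λ t → P-loop t b c) a
  ∨ predecessors (λ t → P-even (sucᶜ a) t c) b ∨ predecessors (λ t → P-even a (sucᶜ b) t) c

N-even-has-move-to-P : ∀ a b c → P-even (class a) (class b) (class c) ≡ false → HasMoveToP (st evenθ a b c)
N-even-has-move-to-P a b c N
  with ∨-true⁻¹ _ (all³-sound P-or-move-to-P-even refl (class a) (class b) (class c))
... | inj₁ P = true≢false (trans (sym P) N)
... | inj₂ h with ∨-true⁻¹ _ h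
... | inj₁ hub = _ , even-hub (notAllZero⁻¹ a b c (∧-conicalˡ _ _ hub)) , ∧-conicalʳ _ _ hub
... | inj₂ h with ∨-true⁻¹ _ h
... | inj₁ ha with predecessors-sound _ a ha
...   | _ , refl , P = _ , even-a , P
N-even-has-move-to-P a b c N | inj₂ _ | inj₂ _ | inj₂ h with ∨-true⁻¹ _ h
... | inj₁ hb with predecessors-sound _ b hb
...   | _ , refl , P = _ , even-b , P
N-even-has-move-to-P a b c N | inj₂ _ | inj₂ _ | inj₂ _ | inj₂ hc with predecessors-sound _ c hc
...   | _ , refl , P = _ , even-c , P

hub-odd : Class³
hub-odd k0 b c = notAllZeroᶜ k0 b c ∧ P-even b c k0
hub-odd _  b c = P-loop b c k0

hub-odd-sucᶜ : ∀ x b c → hub-odd (sucᶜ x) b c ≡ P-loop b c k0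
hub-odd-sucᶜ k0    b c = refl
hub-odd-sucᶜ k1    b c = refl
hub-odd-sucᶜ k2    b c = refl
hub-odd-sucᶜ kOdd  b c = refl
hub-odd-sucᶜ kEven b c = refl

P-or-move-to-P-odd : Class³
P-or-move-to-P-odd a b c =
  P-odd a b c ∨ hub-odd a b c ∨ predecessors (λ t → P-odd (sucᶜ a) t c) b ∨ predecessors (λ t → P-odd a (sucᶜ b) t) c

odd-hub-move-to-P : ∀ a b c → hub-odd (class a) (class b) (class c) ≡ true → HasMoveToP (st oddθ a b c)
odd-hub-move-to-P zero    b c h = _ , odd-hub₀ (notAllZero⁻¹ 0 b c (∧-conicalˡ _ _ h)) , ∧-conicalʳ _ _ h
odd-hub-move-to-P (suc a) b c h = _ , odd-hub₁ , trans (sym (hub-odd-sucᶜ (class a) (class b) (class c))) h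

N-odd-has-move-to-P : ∀ a b c → P-odd (class a) (class b) (class c) ≡ false → HasMoveToP (st oddθ a b c)
N-odd-has-move-to-P a b c N
  with ∨-true⁻¹ _ (all³-sound P-or-move-to-P-odd refl (class a) (class b) (class c))
... | inj₁ P = true≢false (trans (sym P) N)
... | inj₂ h with ∨-true⁻¹ _ h
... | inj₁ hub = odd-hub-move-to-P a b c hub
... | inj₂ h with ∨-true⁻¹ _ h
... | inj₁ hb with predecessors-sound _ b hb
...   | _ , refl , P = _ , odd-b , P
N-odd-has-move-to-P a b c N | inj₂ _ | inj₂ _ | inj₂ hc with predecessors-sound _ c hc
...   | _ , refl , P = _ , odd-c , P

N-has-move-to-P : ∀ s → P-state s ≡ false → HasMoveToP s
N-has-move-to-P (st loop  a b c) = N-loop-has-move-to-P a b c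
N-has-move-to-P (st evenθ a b c) = N-even-has-move-to-P a b c
N-has-move-to-P (st oddθ  a b c) = N-odd-has-move-to-P a b c

-- The total number of colour changes along all paths.
weight : AState → ℕ
weight (st loop  a b c) = 2 * a + 4 * b + 6 * c
weight (st evenθ a b c) = 2 * a + 4 * b + 6 * c
weight (st oddθ  a b c) = a + 3 * b + 5 * c

a-drop₂₄₆ : ∀ a b c → 2 * suc a + 4 * b + 6 * c ≡ 2 * a + 4 * b + 6 * c + 2
a-drop₂₄₆ = solve-∀

b-drop₂₄₆ : ∀ a b c → 2 * a + 4 * suc b + 6 * c ≡ 2 * suc a + 4 * b + 6 * c + 2
b-drop₂₄₆ = solve-∀

c-drop₂₄₆ : ∀ a b c → 2 * a + 4 * b + 6 * suc c ≡ 2 * a + 4 * suc b + 6 * c + 2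
c-drop₂₄₆ = solve-∀

b-drop₁₃₅ : ∀ a b c → a + 3 * suc b + 5 * c ≡ suc a + 3 * b + 5 * c + 2
b-drop₁₃₅ = solve-∀

c-drop₁₃₅ : ∀ a b c → a + 3 * b + 5 * suc c ≡ a + 3 * suc b + 5 * c + 2
c-drop₁₃₅ = solve-∀

hub-drop-loop : ∀ a b c → 2 * a + 4 * b + 6 * c ≡ 2 * b + 4 * c + 6 * 0 + 2 * (a + b + c)
hub-drop-loop = solve-∀

hub-drop-even : ∀ a b c → 2 * a + 4 * b + 6 * c ≡ a + 3 * b + 5 * c + (a + b + c)
hub-drop-even = solve-∀

hub-drop-odd₀ : ∀ b c → 0 + 3 * b + 5 * c ≡ 2 * b + 4 * c + 6 * 0 + (b + c)
hub-drop-odd₀ = solve-∀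

hub-drop-odd₁ : ∀ a b c → suc a + 3 * b + 5 * c ≡ 2 * b + 4 * c + 6 * 0 + suc (a + b + c)
hub-drop-odd₁ = solve-∀

<-by-drop : ∀ {m n k} → 0 < k → n ≡ m + k → m < n
<-by-drop {m} 0<k refl = m<m+n m 0<k

notAllZero⇒0<sum : ∀ {a b c} → NotAllZero a b c → 0 < a + b + c
notAllZero⇒0<sum {suc a}         nz₁ = s≤s z≤n
notAllZero⇒0<sum {a} {suc b} {c} nz₂ = ≤-trans (s≤s z≤n) (≤-trans (m≤n+m (suc b) a) (m≤m+n (a + suc b) c))
notAllZero⇒0<sum {a} {b} {suc c} nz₃ = ≤-trans (s≤s z≤n) (m≤n+m (suc c) (a + b))

weight-decreases : ∀ {s s′} → AMove s s′ → weight s′ < weight s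
weight-decreases (loop-hub {a} {b} {c} nz) = <-by-drop (*-monoʳ-< 2 (notAllZero⇒0<sum nz)) (hub-drop-loop a b c)
weight-decreases (loop-a {a} {b} {c})      = <-by-drop (s≤s z≤n) (a-drop₂₄₆ a b c)
weight-decreases (loop-b {a} {b} {c})      = <-by-drop (s≤s z≤n) (b-drop₂₄₆ a b c)
weight-decreases (loop-c {a} {b} {c})      = <-by-drop (s≤s z≤n) (c-drop₂₄₆ a b c)
weight-decreases (even-hub {a} {b} {c} nz) = <-by-drop (notAllZero⇒0<sum nz) (hub-drop-even a b c)
weight-decreases (even-a {a} {b} {c})      = <-by-drop (s≤s z≤n) (a-drop₂₄₆ a b c)
weight-decreases (even-b {a} {b} {c})      = <-by-drop (s≤s z≤n) (b-drop₂₄₆ a b c)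
weight-decreases (even-c {a} {b} {c})      = <-by-drop (s≤s z≤n) (c-drop₂₄₆ a b c)
weight-decreases (odd-hub₀ {b} {c} nz)     = <-by-drop (notAllZero⇒0<sum nz) (hub-drop-odd₀ b c)
weight-decreases (odd-hub₁ {a} {b} {c})    = <-by-drop (s≤s z≤n) (hub-drop-odd₁ a b c)
weight-decreases (odd-b {a} {b} {c})       = <-by-drop (s≤s z≤n) (b-drop₁₃₅ a b c)
weight-decreases (odd-c {a} {b} {c})       = <-by-drop (s≤s z≤n) (c-drop₁₃₅ a b c)

-- Vertices are handled through their labels toℕ y; path q visits the labels label q 0 = u, …, label q (len q) = v.
record PathSystem : Set where
  field
    G                : Graph
    m                : ℕ
    len              : Fin m → ℕ
    u v              : ℕ
    u<n              : u < n G
    v<n              : v < n G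
    label            : Fin m → ℕ → ℕ
    label-0          : ∀ q → label q 0 ≡ u
    label-len        : ∀ q → label q (len q) ≡ v
    label<n          : ∀ q t → t ≤ len q → label q t < n G
    edge-along-path  : ∀ q t → t < len q → (label q t , label q (suc t)) ∈ edges G
    edge-on-path     : ∀ a b → (a , b) ∈ edges G →
                       Σ[ q ∈ Fin m ] Σ[ t ∈ ℕ ] t < len q × a ≡ label q t × b ≡ label q (suc t)
    covers           : ∀ a → a < n G →
                       a ≡ u ⊎ a ≡ v ⊎ (Σ[ q ∈ Fin m ] Σ[ t ∈ ℕ ] 0 < t × t < len q × a ≡ label q t)
    interior-unique  : ∀ q t q′ t′ → 0 < t → t < len q → t′ ≤ len q′ →
                       label q t ≡ label q′ t′ → q ≡ q′ × t ≡ t′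

module Colourings (P : PathSystem) where
  open PathSystem P

  V : Set
  V = Fin (n G)

  -- The colour of the vertex labelled a (junk value 0 if there is none).
  colourOf : Coloring G → ℕ → ℕ
  colourOf col a with a <? n G
  ... | yes a<n = col (fromℕ< a<n)
  ... | no  _   = 0

  colourOf-toℕ : ∀ col y → colourOf col (toℕ y) ≡ col y
  colourOf-toℕ col y with toℕ y <? n G
  ... | yes y<n = cong col (fromℕ<-toℕ y y<n)
  ... | no  y≮n = ⊥-elim (y≮n (toℕ<n y))

  colourOf-fromℕ< : ∀ col a (a<n : a < n G) → colourOf col a ≡ col (fromℕ< a<n)
  colourOf-fromℕ< col a a<n = trans (cong (colourOf col) (sym (toℕ-fromℕ< a<n))) (colourOf-toℕ col (fromℕ< a<n))

  word : Coloring G → Fin m → ℕ → ℕ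
  word col q t = colourOf col (label q t)

  word-at : ∀ col q t y → toℕ y ≡ label q t → word col q t ≡ col y
  word-at col q t y y≡ = trans (cong (colourOf col) (sym y≡)) (colourOf-toℕ col y)

  Δ : Coloring G → Fin m → ℕ
  Δ col q = changes (word col q) (len q)

  vertexAt : ∀ q t → t ≤ len q → V
  vertexAt q t t≤ = fromℕ< (label<n q t t≤)

  vertexAt-label : ∀ q t (t≤ : t ≤ len q) → toℕ (vertexAt q t t≤) ≡ label q t
  vertexAt-label q t t≤ = toℕ-fromℕ< (label<n q t t≤)

  adj-along : ∀ q t → t < len q → ∀ y z → toℕ y ≡ label q t → toℕ z ≡ label q (suc t) → Adj G y z
  adj-along q t t< y z y≡ z≡ = inj₁ (subst₂ (λ a b → (a , b) ∈ edges G) (sym y≡) (sym z≡) (edge-along-path q t t<))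

  adj-sym : ∀ {y z} → Adj G y z → Adj G z y
  adj-sym (inj₁ e) = inj₂ e
  adj-sym (inj₂ e) = inj₁ e

  adj-on-path : ∀ {y z} → Adj G y z → Σ[ q ∈ Fin m ] Σ[ t ∈ ℕ ] t < len q ×
    ((toℕ y ≡ label q t × toℕ z ≡ label q (suc t)) ⊎ (toℕ y ≡ label q (suc t) × toℕ z ≡ label q t))
  adj-on-path (inj₁ e) with edge-on-path _ _ e
  ... | q , t , t< , y≡ , z≡ = q , t , t< , inj₁ (y≡ , z≡)
  adj-on-path (inj₂ e) with edge-on-path _ _ e
  ... | q , t , t< , z≡ , y≡ = q , t , t< , inj₂ (y≡ , z≡)

  Binary : Coloring G → Set
  Binary col = ∀ y → col y < 2

  colourOf-binary : ∀ col → Binary col → ∀ a → colourOf col a < 2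
  colourOf-binary col bin a with a <? n G
  ... | yes a<n = bin (fromℕ< a<n)
  ... | no  _   = s≤s z≤n

  binary-other : ∀ {a c c′} → a < 2 → c < 2 → c′ < 2 → c ≢ c′ → a ≢ c → a ≡ c′
  binary-other {0} {0} _ _ _ _ a≢c = ⊥-elim (a≢c refl)
  binary-other {0} {1} {0} _ _ _ _ _ = refl
  binary-other {0} {1} {1} _ _ _ c≢c′ _ = ⊥-elim (c≢c′ refl)
  binary-other {1} {0} {0} _ _ _ c≢c′ _ = ⊥-elim (c≢c′ refl)
  binary-other {1} {0} {1} _ _ _ _ _ = refl
  binary-other {1} {1} _ _ _ _ a≢c = ⊥-elim (a≢c refl)
  binary-other {suc (suc _)} (s≤s (s≤s ())) _ _ _ _
  binary-other {_} {suc (suc _)} _ (s≤s (s≤s ())) _ _ _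
  binary-other {0} {1} {suc (suc _)} _ _ (s≤s (s≤s ())) _ _
  binary-other {1} {0} {suc (suc _)} _ _ (s≤s (s≤s ())) _ _

  conn-colour : ∀ {col c x y} → Conn G col c x y → col y ≡ c
  conn-colour (here e)     = e
  conn-colour (step _ _ e) = e

  conn-self : ∀ {col x} z → toℕ z ≡ toℕ x → Conn G col (col x) x z
  conn-self z z≡x with toℕ-injective z≡x
  ... | refl = here refl

  ReachesAt : Coloring G → ℕ → V → Fin m → ℕ → Set
  ReachesAt col c x q t = ∀ z → toℕ z ≡ label q t → Conn G col c x z

  reaches-next : ∀ {col c x} q t → t < len q → word col q (suc t) ≡ c → ReachesAt col c x q t → ReachesAt col c x q (suc t)
  reaches-next {col} q t t< w≡c r z z≡ =
    step (r y (vertexAt-label q t (<⇒≤ t<))) (adj-along q t t< y z (vertexAt-label q t (<⇒≤ t<)) z≡)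
         (trans (sym (word-at col q (suc t) z z≡)) w≡c)
    where
    y : V
    y = vertexAt q t (<⇒≤ t<)

  reaches-prev : ∀ {col c x} q t → t < len q → word col q t ≡ c → ReachesAt col c x q (suc t) → ReachesAt col c x q t
  reaches-prev {col} q t t< w≡c r z z≡ =
    step (r y (vertexAt-label q (suc t) t<)) (adj-sym (adj-along q t t< z y z≡ (vertexAt-label q (suc t) t<)))
         (trans (sym (word-at col q t z z≡)) w≡c)
    where
    y : V
    y = vertexAt q (suc t) t<

  reaches-up : ∀ {col c x} q i j → i ≤ j → j ≤ len q → (∀ t → i ≤ t → t ≤ j → word col q t ≡ c) →
    ReachesAt col c x q i → ReachesAt col c x q j
  reaches-up q i zero    i≤0 _ _ r = subst (ReachesAt _ _ _ q) (n≤0⇒n≡0 i≤0) r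
  reaches-up q i (suc j) i≤j j< mono r with m≤n⇒m<n∨m≡n i≤j
  ... | inj₂ refl = r
  ... | inj₁ i<1+j = reaches-next q j j< (mono (suc j) (<⇒≤ i<1+j) ≤-refl)
        (reaches-up q i j (≤-pred i<1+j) (<⇒≤ j<) (λ t i≤t t≤j → mono t i≤t (m≤n⇒m≤1+n t≤j)) r)

  reaches-down : ∀ {col c x} q i j → i ≤ j → j ≤ len q → (∀ t → i ≤ t → t ≤ j → word col q t ≡ c) →
    ReachesAt col c x q j → ReachesAt col c x q i
  reaches-down q i zero    i≤0 _ _ r = subst (ReachesAt _ _ _ q) (sym (n≤0⇒n≡0 i≤0)) r
  reaches-down q i (suc j) i≤j j< mono r with m≤n⇒m<n∨m≡n i≤j
  ... | inj₂ refl = r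
  ... | inj₁ i<1+j = reaches-down q i j (≤-pred i<1+j) (<⇒≤ j<) (λ t i≤t t≤j → mono t i≤t (m≤n⇒m≤1+n t≤j))
        (reaches-prev q j j< (mono j (≤-pred i<1+j) (n≤1+n j)) r)

  Location : ℕ → Set
  Location a = a ≡ u ⊎ a ≡ v ⊎ (Σ[ q ∈ Fin m ] Σ[ t ∈ ℕ ] 0 < t × t < len q × a ≡ label q t)

  locate : ∀ (y : V) → Location (toℕ y)
  locate y = covers (toℕ y) (toℕ<n y)

  Recolouring : Coloring G → Coloring G → ℕ → ℕ → V → Set
  Recolouring col col′ c c′ x = ∀ y → (Conn G col c x y → col′ y ≡ c′) × (¬ Conn G col c x y → col′ y ≡ col y)

  interior≢u : ∀ q t → 0 < t → t < len q → label q t ≢ u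
  interior≢u q t 0<t t< e = <-irrefl (sym (proj₂ (interior-unique q t q 0 0<t t< z≤n (trans e (sym (label-0 q)))))) 0<t

  interior≢v : ∀ q t → 0 < t → t < len q → label q t ≢ v
  interior≢v q t 0<t t< e = <-irrefl (proj₂ (interior-unique q t q (len q) 0<t t< ≤-refl (trans e (sym (label-len q))))) t<

  record Marking : Set where
    field
      J     : Fin m → ℕ → Bool
      atU   : Bool
      atV   : Bool
      J-0   : ∀ q → J q 0 ≡ atU
      J-len : ∀ q → J q (len q) ≡ atV
      J-u≡v : u ≡ v → atU ≡ atV

  open Marking public

  markAt : Marking → ∀ {a} → Location a → Bool
  markAt M (inj₁ _)                   = atU M
  markAt M (inj₂ (inj₁ _))            = atV M
  markAt M (inj₂ (inj₂ (q , t , _))) = J M q t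

  marked : Marking → V → Bool
  marked M y = markAt M (locate y)

  markAt-on-path : ∀ M {a} (loc : Location a) q t → t ≤ len q → a ≡ label q t → markAt M loc ≡ J M q t
  markAt-on-path M (inj₁ a≡u) q t t≤ a≡ with t ≟ 0 | t ≟ len q
  ... | yes refl | _        = sym (J-0 M q)
  ... | no  _    | yes refl = trans (J-u≡v M (trans (sym a≡u) (trans a≡ (label-len q)))) (sym (J-len M q))
  ... | no  t≢0  | no  t≢L  = ⊥-elim (interior≢u q t (n≢0⇒n>0 t≢0) (≤∧≢⇒< t≤ t≢L) (trans (sym a≡) a≡u))
  markAt-on-path M (inj₂ (inj₁ a≡v)) q t t≤ a≡ with t ≟ len q | t ≟ 0
  ... | yes refl | _        = sym (J-len M q)
  ... | no  _    | yes refl = trans (sym (J-u≡v M (trans (sym (label-0 q)) (trans (sym a≡) a≡v)))) (sym (J-0 M q))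
  ... | no  t≢L  | no  t≢0  = ⊥-elim (interior≢v q t (n≢0⇒n>0 t≢0) (≤∧≢⇒< t≤ t≢L) (trans (sym a≡) a≡v))
  markAt-on-path M (inj₂ (inj₂ (q′ , t′ , 0<t′ , t′< , a≡′))) q t t≤ a≡
    with interior-unique q′ t′ q t 0<t′ t′< t≤ (trans (sym a≡′) a≡)
  ... | refl , refl = refl

  marked-on-path : ∀ M y q t → t ≤ len q → toℕ y ≡ label q t → marked M y ≡ J M q t
  marked-on-path M y = markAt-on-path M (locate y)

  marked-u : ∀ M y → toℕ y ≡ u → marked M y ≡ atU M
  marked-u M y y≡u with locate y
  ... | inj₁ _                            = refl
  ... | inj₂ (inj₁ y≡v)                   = sym (J-u≡v M (trans (sym y≡u) y≡v))
  ... | inj₂ (inj₂ (q , t , 0<t , t< , y≡)) = ⊥-elim (interior≢u q t 0<t t< (trans (sym y≡) y≡u))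

  marked-v : ∀ M y → toℕ y ≡ v → marked M y ≡ atV M
  marked-v M y y≡v with locate y
  ... | inj₁ y≡u                          = J-u≡v M (trans (sym y≡u) y≡v)
  ... | inj₂ (inj₁ _)                     = refl
  ... | inj₂ (inj₂ (q , t , 0<t , t< , y≡)) = ⊥-elim (interior≢v q t 0<t t< (trans (sym y≡) y≡v))

  record IsComponent (M : Marking) (col : Coloring G) (c : ℕ) (x : V) : Set where
    field
      closed-next : ∀ q t → t < len q → J M q t ≡ true → word col q (suc t) ≡ c → J M q (suc t) ≡ true
      closed-prev : ∀ q t → t < len q → J M q (suc t) ≡ true → word col q t ≡ c → J M q t ≡ true
      marks-x     : marked M x ≡ true
      reaches     : ∀ y → marked M y ≡ true → Conn G col c x y

  module Component {M col c x} (K : IsComponent M col c x) where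
    open IsComponent K

    conn⇒marked : ∀ {y} → Conn G col c x y → marked M y ≡ true
    conn⇒marked (here _) = marks-x
    conn⇒marked (step {y} {z} x~y y-z z≡c) with adj-on-path y-z
    ... | q , t , t< , inj₁ (y≡ , z≡) =
      trans (marked-on-path M z q (suc t) t< z≡)
        (closed-next q t t< (trans (sym (marked-on-path M y q t (<⇒≤ t<) y≡)) (conn⇒marked x~y))
                            (trans (word-at col q (suc t) z z≡) z≡c))
    ... | q , t , t< , inj₂ (y≡ , z≡) =
      trans (marked-on-path M z q t (<⇒≤ t<) z≡)
        (closed-prev q t t< (trans (sym (marked-on-path M y q (suc t) t< y≡)) (conn⇒marked x~y))
                            (trans (word-at col q t z z≡) z≡c))

    unmarked⇒¬conn : ∀ {y} → marked M y ≡ false → ¬ Conn G col c x y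
    unmarked⇒¬conn y∉ x~y = true≢false (trans (sym (conn⇒marked x~y)) y∉)

    marked-colour : ∀ q t → t ≤ len q → J M q t ≡ true → word col q t ≡ c
    marked-colour q t t≤ Jt =
      trans (word-at col q t y (vertexAt-label q t t≤))
            (conn-colour (reaches y (trans (marked-on-path M y q t t≤ (vertexAt-label q t t≤)) Jt)))
      where
      y : V
      y = vertexAt q t t≤

    recoloured-word : ∀ {col′ c′} → Recolouring col col′ c c′ x → ∀ q t → t ≤ len q →
      Recoloured c c′ (J M q t) (word col q t) (word col′ q t)
    recoloured-word {col′} rec q t t≤ =
        (λ Jt → marked-colour q t t≤ Jt ,
                trans (word-at col′ q t y y≡) (proj₁ (rec y) (reaches y (trans (marked-on-path M y q t t≤ y≡) Jt))))
      , (λ Jf → trans (word-at col′ q t y y≡)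
                  (trans (proj₂ (rec y) (unmarked⇒¬conn (trans (marked-on-path M y q t t≤ y≡) Jf)))
                         (sym (word-at col q t y y≡))))
      where
      y : V
      y = vertexAt q t t≤
      y≡ : toℕ y ≡ label q t
      y≡ = vertexAt-label q t t≤

    recolouring-binary : ∀ {col′ c′} → Recolouring col col′ c c′ x → c′ < 2 → Binary col → Binary col′
    recolouring-binary rec c′<2 bin y with marked M y in e
    ... | true  = subst (_< 2) (sym (proj₁ (rec y) (reaches y e))) c′<2
    ... | false = subst (_< 2) (sym (proj₂ (rec y) (unmarked⇒¬conn e))) (bin y)

    recolour : ℕ → Coloring G
    recolour c′ y = if marked M y then c′ else col y

    recolour-is-recolouring : ∀ c′ → Recolouring col (recolour c′) c c′ x
    recolour-is-recolouring c′ y with marked M y in e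
    ... | true  = (λ _ → refl) , (λ ¬x~y → ⊥-elim (¬x~y (reaches y e)))
    ... | false = (λ x~y → ⊥-elim (unmarked⇒¬conn e x~y)) , (λ _ → refl)

    -- Recolouring turns exactly the edges leaving the component from bichromatic into monochromatic ones.
    Δ-recolour : ∀ {col′ c′} → Recolouring col col′ c c′ x → Binary col → c < 2 → c′ < 2 → c ≢ c′ → ∀ q →
      Δ col′ q + cuts (J M q) (len q) ≡ Δ col q
    Δ-recolour {col′} rec bin c<2 c′<2 c≢c′ q = changes-recolour (len q) (word col q) (word col′ q) (J M q) edge
      where
      edge : ∀ t → t < len q → change (word col′ q t) (word col′ q (suc t)) + cut (J M q t) (J M q (suc t))
                               ≡ change (word col q t) (word col q (suc t))
      edge t t< = change-recolour (J M q t) (J M q (suc t)) c≢c′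
        (recoloured-word rec q t (<⇒≤ t<)) (recoloured-word rec q (suc t) t<)
        (λ Jt Jf → binary-other (colourOf-binary col bin _) c<2 c′<2 c≢c′
                     (λ w≡c → true≢false (trans (sym (closed-next q t t< Jt w≡c)) Jf)))
        (λ Jt Jf → binary-other (colourOf-binary col bin _) c<2 c′<2 c≢c′
                     (λ w≡c → true≢false (trans (sym (closed-prev q t t< Jt w≡c)) Jf)))

  onInterval : Fin m → ℕ → ℕ → Fin m → ℕ → Bool
  onInterval p a b q t with q ≟ᶠ p
  ... | yes _ = (a <ᵇ t) ∧ (t <ᵇ suc b)
  ... | no  _ = false

  onInterval-same : ∀ p a b t → onInterval p a b p t ≡ ((a <ᵇ t) ∧ (t <ᵇ suc b))
  onInterval-same p a b t with p ≟ᶠ p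
  ... | yes _   = refl
  ... | no  p≢p = ⊥-elim (p≢p refl)

  onInterval-other : ∀ p a b q t → q ≢ p → onInterval p a b q t ≡ false
  onInterval-other p a b q t q≢p with q ≟ᶠ p
  ... | yes q≡p = ⊥-elim (q≢p q≡p)
  ... | no  _   = refl

  onInterval⁻¹ : ∀ p a b q t → onInterval p a b q t ≡ true → q ≡ p × a < t × t ≤ b
  onInterval⁻¹ p a b q t h with q ≟ᶠ p
  ... | yes refl = refl , <ᵇ-true⁻¹ (∧-conicalˡ _ _ h) , ≤-pred (<ᵇ-true⁻¹ (∧-conicalʳ (a <ᵇ t) _ h))

  onInterval-intro : ∀ p a b t → a < t → t ≤ b → onInterval p a b p t ≡ true
  onInterval-intro p a b t a<t t≤b = trans (onInterval-same p a b t) (cong₂ _∧_ (<ᵇ-true a<t) (<ᵇ-true (s≤s t≤b)))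

  intervalMarking : (p : Fin m) (a b : ℕ) → b < len p → Marking
  intervalMarking p a b b<len = record
    { J = onInterval p a b ; atU = false ; atV = false ; J-0 = J-0′ ; J-len = J-len′ ; J-u≡v = λ _ → refl }
    where
    J-0′ : ∀ q → onInterval p a b q 0 ≡ false
    J-0′ q with q ≟ᶠ p
    ... | yes _ = refl
    ... | no  _ = refl
    J-len′ : ∀ q → onInterval p a b q (len q) ≡ false
    J-len′ q with q ≟ᶠ p
    ... | yes refl = trans (cong ((a <ᵇ len q) ∧_) (<ᵇ-false b<len)) (∧-zeroʳ _)
    ... | no  _    = refl

  module InteriorComponent (col : Coloring G) (p : Fin m) (s : ℕ) (x : V) (x≡ : toℕ x ≡ label p s) (s≤ : s ≤ len p)
    (a : ℕ) (start≡ : runStart (col x) (word col p) s ≡ suc a) (end< : runEnd (col x) (word col p) s (len p ∸ s) < len p)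
    where

    c : ℕ
    c = col x
    w : ℕ → ℕ
    w = word col p
    b : ℕ
    b = runEnd c w s (len p ∸ s)
    M : Marking
    M = intervalMarking p a b end<

    w-s : w s ≡ c
    w-s = word-at col p s x x≡

    a<s : a < s
    a<s = subst (_≤ s) start≡ (runStart≤ c w s)

    s≤b : s ≤ b
    s≤b = s≤runEnd c w s (len p ∸ s)

    b<s+ : b < s + (len p ∸ s)
    b<s+ = subst (b <_) (sym (m+[n∸m]≡n s≤)) end<

    closed-next : ∀ q t → t < len q → onInterval p a b q t ≡ true → word col q (suc t) ≡ c →
      onInterval p a b q (suc t) ≡ true
    closed-next q t t< Jt w≡c with onInterval⁻¹ p a b q t Jt
    ... | refl , a<t , t≤b with m≤n⇒m<n∨m≡n t≤b
    ...   | inj₁ t<b  = onInterval-intro p a b (suc t) (m<n⇒m<1+n a<t) t<b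
    ...   | inj₂ refl = ⊥-elim (runEnd-stops c w s (len p ∸ s) b<s+ w≡c)

    closed-prev : ∀ q t → t < len q → onInterval p a b q (suc t) ≡ true → word col q t ≡ c →
      onInterval p a b q t ≡ true
    closed-prev q t t< J1+t w≡c with onInterval⁻¹ p a b q (suc t) J1+t
    ... | refl , a<1+t , 1+t≤b with m≤n⇒m<n∨m≡n a<1+t
    ...   | inj₁ 1+a<1+t = onInterval-intro p a b t (≤-pred 1+a<1+t) (≤-trans (n≤1+n t) 1+t≤b)
    ...   | inj₂ 1+a≡1+t = ⊥-elim (runStart-stops c w s t (trans start≡ 1+a≡1+t) w≡c)

    marks-x : marked M x ≡ true
    marks-x = trans (marked-on-path M x p s s≤ x≡) (onInterval-intro p a b s a<s s≤b)

    reaches-x : ReachesAt col c x p s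
    reaches-x z z≡ = conn-self z (trans z≡ (sym x≡))

    reachesAt : ∀ {y} (loc : Location (toℕ y)) → markAt M loc ≡ true → Conn G col c x y
    reachesAt {y} (inj₂ (inj₂ (q , t , _ , t< , y≡))) Jt with onInterval⁻¹ p a b q t Jt
    ... | refl , a<t , t≤b with ≤-total s t
    ...   | inj₁ s≤t = reaches-up p s t s≤t (<⇒≤ t<)
                         (λ i s≤i i≤t → runEnd-const c w s (len p ∸ s) w-s i s≤i (≤-trans i≤t t≤b)) reaches-x y y≡
    ...   | inj₂ t≤s = reaches-down p t s t≤s s≤
                         (λ i t≤i i≤s → runStart-const c w s w-s i (≤-trans (≤-reflexive start≡) (≤-trans a<t t≤i)) i≤s)
                         reaches-x y y≡

    component : IsComponent M col c x
    component = record
      { closed-next = closed-next ; closed-prev = closed-prev ; marks-x = marks-x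
      ; reaches = λ y → reachesAt (locate y) }

    open Component component public

    module _ {col′ c′} (rec : Recolouring col col′ c c′ x) (bin : Binary col) (c′<2 : c′ < 2) (c≢c′ : c ≢ c′) where

      Δ-interior : Δ col′ p + 2 ≡ Δ col p
      Δ-interior = trans (cong (Δ col′ p +_) (sym two-cuts)) (Δ-recolour rec bin (bin x) c′<2 c≢c′ p)
        where
        two-cuts : cuts (onInterval p a b p) (len p) ≡ 2
        two-cuts = cuts-δ+δ (onInterval p a b p) (len p) a b (≤-trans a<s s≤) end<
          (λ t _ → trans (cong₂ cut (onInterval-same p a b t) (onInterval-same p a b (suc t)))
                         (cut-interval a b t (≤-trans a<s s≤b)))

      Δ-elsewhere : ∀ q → q ≢ p → Δ col′ q ≡ Δ col q
      Δ-elsewhere q q≢p = trans (sym (+-identityʳ _))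
        (trans (cong (Δ col′ q +_) (sym no-cuts)) (Δ-recolour rec bin (bin x) c′<2 c≢c′ q))
        where
        no-cuts : cuts (onInterval p a b q) (len q) ≡ 0
        no-cuts = cuts-const (onInterval p a b q) (len q) false (λ t _ → onInterval-other p a b q t q≢p)

  firstRunEnd : Coloring G → ℕ → Fin m → ℕ
  firstRunEnd col c q = runEnd c (word col q) 0 (len q)

  lastRunStart : Coloring G → ℕ → Fin m → ℕ
  lastRunStart col c q = runStart c (word col q) (len q)

  firstRunEnd≤ : ∀ col c q → firstRunEnd col c q ≤ len q
  firstRunEnd≤ col c q = runEnd≤ c (word col q) 0 (len q)

  lastRunStart≤ : ∀ col c q → lastRunStart col c q ≤ len q
  lastRunStart≤ col c q = runStart≤ c (word col q) (len q)

  -- The initial c-run of every path if mu, and the final c-run of every path if mv.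
  endRuns : Coloring G → ℕ → Bool → Bool → Fin m → ℕ → Bool
  endRuns col c mu mv q t = (mu ∧ (t <ᵇ suc (firstRunEnd col c q))) ∨ (mv ∧ (lastRunStart col c q <ᵇ suc t))

  endRuns⁻¹ : ∀ col c mu mv q t → endRuns col c mu mv q t ≡ true →
    (mu ≡ true × t ≤ firstRunEnd col c q) ⊎ (mv ≡ true × lastRunStart col c q ≤ t)
  endRuns⁻¹ col c true mv q t h with t <ᵇ suc (firstRunEnd col c q) in e
  ... | true  = inj₁ (refl , ≤-pred (<ᵇ-true⁻¹ e))
  ... | false = inj₂ (∧-conicalˡ mv _ h , ≤-pred (<ᵇ-true⁻¹ (∧-conicalʳ mv _ h)))
  endRuns⁻¹ col c false mv q t h = inj₂ (∧-conicalˡ mv _ h , ≤-pred (<ᵇ-true⁻¹ (∧-conicalʳ mv _ h)))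

  endRuns-first : ∀ col c mv q t → t ≤ firstRunEnd col c q → endRuns col c true mv q t ≡ true
  endRuns-first col c mv q t t≤e = cong (_∨ (mv ∧ (lastRunStart col c q <ᵇ suc t))) (<ᵇ-true (s≤s t≤e))

  endRuns-last : ∀ col c mu q t → lastRunStart col c q ≤ t → endRuns col c mu true q t ≡ true
  endRuns-last col c mu q t g≤t = trans (cong ((mu ∧ (t <ᵇ suc (firstRunEnd col c q))) ∨_) (<ᵇ-true (s≤s g≤t))) (∨-zeroʳ _)

  endRuns-0 : ∀ col c mu mv → (mv ≡ true → ∀ q → lastRunStart col c q ≡ 0 → mu ≡ true) →
    ∀ q → endRuns col c mu mv q 0 ≡ mu
  endRuns-0 col c true  mv    _        q = refl
  endRuns-0 col c false false _        q = refl
  endRuns-0 col c false true  u-forced q with lastRunStart col c q in g≡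
  ... | zero  = true≢false (sym (u-forced refl q g≡))
  ... | suc _ = refl

  endRuns-len : ∀ col c mu mv → (mu ≡ true → ∀ q → firstRunEnd col c q ≡ len q → mv ≡ true) →
    ∀ q → endRuns col c mu mv q (len q) ≡ mv
  endRuns-len col c mu    true  _        q = endRuns-last col c mu q (len q) (lastRunStart≤ col c q)
  endRuns-len col c false false _        q = refl
  endRuns-len col c true  false v-forced q with len q <ᵇ suc (firstRunEnd col c q) in e
  ... | false = refl
  ... | true  = true≢false (sym (v-forced refl q (≤-antisym (firstRunEnd≤ col c q) (≤-pred (<ᵇ-true⁻¹ e)))))

  endRunsMarking : ∀ col c mu mv → (mv ≡ true → ∀ q → lastRunStart col c q ≡ 0 → mu ≡ true) →
    (mu ≡ true → ∀ q → firstRunEnd col c q ≡ len q → mv ≡ true) → (u ≡ v → mu ≡ mv) → Marking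
  endRunsMarking col c mu mv u-forced v-forced mu≡mv = record
    { J = endRuns col c mu mv ; atU = mu ; atV = mv
    ; J-0 = endRuns-0 col c mu mv u-forced ; J-len = endRuns-len col c mu mv v-forced ; J-u≡v = mu≡mv }

  ReachesU ReachesV : Coloring G → V → Set
  ReachesU col x = ∀ z → toℕ z ≡ u → Conn G col (col x) x z
  ReachesV col x = ∀ z → toℕ z ≡ v → Conn G col (col x) x z

  OnEndRuns : Coloring G → V → Bool → Bool → Set
  OnEndRuns col x mu mv = (toℕ x ≡ u × mu ≡ true) ⊎ (toℕ x ≡ v × mv ≡ true) ⊎
    (Σ[ p ∈ Fin m ] Σ[ s ∈ ℕ ] s ≤ len p × toℕ x ≡ label p s × endRuns col (col x) mu mv p s ≡ true)

  reachesU-word : ∀ {col x} → ReachesU col x → ∀ q → word col q 0 ≡ col x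
  reachesU-word {col} r q = trans (word-at col q 0 y (vertexAt-label q 0 z≤n))
                                  (conn-colour (r y (trans (vertexAt-label q 0 z≤n) (label-0 q))))
    where
    y : V
    y = vertexAt q 0 z≤n

  reachesV-word : ∀ {col x} → ReachesV col x → ∀ q → word col q (len q) ≡ col x
  reachesV-word {col} r q = trans (word-at col q (len q) y (vertexAt-label q (len q) ≤-refl))
                                  (conn-colour (r y (trans (vertexAt-label q (len q) ≤-refl) (label-len q))))
    where
    y : V
    y = vertexAt q (len q) ≤-refl

  module HubComponent (col : Coloring G) (x : V) (mu mv : Bool)
    (reach-u : mu ≡ true → ReachesU col x) (reach-v : mv ≡ true → ReachesV col x)
    (u-forced : mv ≡ true → ∀ q → lastRunStart col (col x) q ≡ 0 → mu ≡ true)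
    (v-forced : mu ≡ true → ∀ q → firstRunEnd col (col x) q ≡ len q → mv ≡ true)
    (mu≡mv : u ≡ v → mu ≡ mv) (x-on : OnEndRuns col x mu mv)
    where

    c : ℕ
    c = col x
    M : Marking
    M = endRunsMarking col c mu mv u-forced v-forced mu≡mv

    closed-next : ∀ q t → t < len q → endRuns col c mu mv q t ≡ true → word col q (suc t) ≡ c →
      endRuns col c mu mv q (suc t) ≡ true
    closed-next q t t< Jt w≡c with endRuns⁻¹ col c mu mv q t Jt
    ... | inj₂ (refl , g≤t) = endRuns-last col c mu q (suc t) (m≤n⇒m≤1+n g≤t)
    ... | inj₁ (refl , t≤e) with m≤n⇒m<n∨m≡n t≤e
    ...   | inj₁ t<e  = endRuns-first col c mv q (suc t) t<e
    ...   | inj₂ refl = ⊥-elim (runEnd-stops c (word col q) 0 (len q) t< w≡c)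

    closed-prev : ∀ q t → t < len q → endRuns col c mu mv q (suc t) ≡ true → word col q t ≡ c →
      endRuns col c mu mv q t ≡ true
    closed-prev q t t< J1+t w≡c with endRuns⁻¹ col c mu mv q (suc t) J1+t
    ... | inj₁ (refl , 1+t≤e) = endRuns-first col c mv q t (≤-trans (n≤1+n t) 1+t≤e)
    ... | inj₂ (refl , g≤1+t) with m≤n⇒m<n∨m≡n g≤1+t
    ...   | inj₁ g<1+t = endRuns-last col c mu q t (≤-pred g<1+t)
    ...   | inj₂ g≡1+t = ⊥-elim (runStart-stops c (word col q) (len q) t g≡1+t w≡c)

    marks : OnEndRuns col x mu mv → marked M x ≡ true
    marks (inj₁ (x≡u , mu≡true))                = trans (marked-u M x x≡u) mu≡true
    marks (inj₂ (inj₁ (x≡v , mv≡true)))         = trans (marked-v M x x≡v) mv≡true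
    marks (inj₂ (inj₂ (p , s , s≤ , x≡ , Jps))) = trans (marked-on-path M x p s s≤ x≡) Jps

    reachesAt : ∀ {y} (loc : Location (toℕ y)) → markAt M loc ≡ true → Conn G col c x y
    reachesAt {y} (inj₁ y≡u)      mu≡true = reach-u mu≡true y y≡u
    reachesAt {y} (inj₂ (inj₁ y≡v)) mv≡true = reach-v mv≡true y y≡v
    reachesAt {y} (inj₂ (inj₂ (q , t , _ , t< , y≡))) Jt with endRuns⁻¹ col c mu mv q t Jt
    ... | inj₁ (refl , t≤e) =
      reaches-up q 0 t z≤n (<⇒≤ t<)
        (λ i _ i≤t → runEnd-const c (word col q) 0 (len q) (reachesU-word (reach-u refl) q) i z≤n (≤-trans i≤t t≤e))
        (λ z z≡ → reach-u refl z (trans z≡ (label-0 q))) y y≡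
    ... | inj₂ (refl , g≤t) =
      reaches-down q t (len q) (<⇒≤ t<) ≤-refl
        (λ i t≤i i≤L → runStart-const c (word col q) (len q) (reachesV-word (reach-v refl) q) i (≤-trans g≤t t≤i) i≤L)
        (λ z z≡ → reach-v refl z (trans z≡ (label-len q))) y y≡

    component : IsComponent M col c x
    component = record
      { closed-next = closed-next ; closed-prev = closed-prev ; marks-x = marks x-on
      ; reaches = λ y → reachesAt (locate y) }

    open Component component public

  cuts-first-run : ∀ col c q → firstRunEnd col c q < len q → cuts (endRuns col c true false q) (len q) ≡ 1
  cuts-first-run col c q e< = cuts-δ (endRuns col c true false q) (len q) e e<
    (λ t _ → trans (cong₂ cut (∨-identityʳ (t <ᵇ suc e)) (∨-identityʳ (suc t <ᵇ suc e))) (cut-prefix e t))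
    where
    e : ℕ
    e = firstRunEnd col c q

  cuts-last-run : ∀ col c q g → lastRunStart col c q ≡ suc g → cuts (endRuns col c false true q) (len q) ≡ 1
  cuts-last-run col c q g g≡ = cuts-δ (endRuns col c false true q) (len q) g
    (subst (_≤ len q) g≡ (lastRunStart≤ col c q))
    (λ t _ → trans (cong₂ (λ x y → cut x y) (cong (_<ᵇ suc t) g≡) (cong (_<ᵇ suc (suc t)) g≡)) (cut-suffix g t))

  cuts-whole-run : ∀ col c q → firstRunEnd col c q ≡ len q → cuts (endRuns col c true true q) (len q) ≡ 0
  cuts-whole-run col c q e≡ = cuts-const (endRuns col c true true q) (len q) true
    (λ t t≤ → cong (_∨ (lastRunStart col c q <ᵇ suc t)) (<ᵇ-true (s≤s (subst (t ≤_) (sym e≡) t≤))))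

  cuts-both-runs : ∀ col c q g → firstRunEnd col c q < g → lastRunStart col c q ≡ suc g →
    cuts (endRuns col c true true q) (len q) ≡ 2
  cuts-both-runs col c q g e<g g≡ = cuts-δ+δ (endRuns col c true true q) (len q) e g
    (<-≤-trans e<g (≤-trans (n≤1+n g) (subst (_≤ len q) g≡ (lastRunStart≤ col c q))))
    (subst (_≤ len q) g≡ (lastRunStart≤ col c q))
    (λ t _ → trans (cong₂ (λ x y → cut ((t <ᵇ suc e) ∨ x) ((suc t <ᵇ suc e) ∨ y))
                          (cong (_<ᵇ suc t) g≡) (cong (_<ᵇ suc (suc t)) g≡))
                   (cut-prefix∪suffix e g t e<g))
    where
    e : ℕ
    e = firstRunEnd col c q

module MoveEffects (P : PathSystem) where
  open PathSystem P
  open Colourings P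

  -- u and v lie in one monochromatic part: they coincide or some path has no colour change.
  Fused : (Fin m → ℕ) → Set
  Fused d = u ≡ v ⊎ Σ[ q ∈ Fin m ] d q ≡ 0

  fused? : ∀ d → Dec (Fused d)
  fused? d with u ≟ v | any? (λ q → d q ≟ 0)
  ... | yes u≡v | _        = yes (inj₁ u≡v)
  ... | no  _   | yes d≡0  = yes (inj₂ d≡0)
  ... | no  u≢v | no  ¬d≡0 = no λ { (inj₁ u≡v) → u≢v u≡v ; (inj₂ d≡0) → ¬d≡0 d≡0 }

  data ΔStep (d d′ : Fin m → ℕ) : Set where
    inside   : ∀ p → d′ p + 2 ≡ d p → (∀ q → q ≢ p → d′ q ≡ d q) → ΔStep d d′
    hub-θ    : u ≢ v → (∀ q → 1 ≤ d q) → Fin m → (∀ q → d′ q + 1 ≡ d q) → ΔStep d d′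
    hub-loop : Fused d → (Σ[ q ∈ Fin m ] 1 ≤ d q) → (∀ q → d′ q ≡ d q ∸ 2) → ΔStep d d′

  Δ≡0⇒constant : ∀ col q → Δ col q ≡ 0 → ∀ t → t ≤ len q → word col q t ≡ word col q 0
  Δ≡0⇒constant col q = changes≡0⇒const (word col q) (len q)

  firstRunEnd≡len⇒Δ≡0 : ∀ col c q → word col q 0 ≡ c → firstRunEnd col c q ≡ len q → Δ col q ≡ 0
  firstRunEnd≡len⇒Δ≡0 col c q w0 e≡ = changes-const (len q)
    (λ t t≤ → runEnd-const c (word col q) 0 (len q) w0 t z≤n (subst (t ≤_) (sym e≡) t≤))

  lastRunStart≡0⇒Δ≡0 : ∀ col c q → word col q (len q) ≡ c → lastRunStart col c q ≡ 0 → Δ col q ≡ 0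
  lastRunStart≡0⇒Δ≡0 col c q wL g≡0 = changes-const (len q)
    (λ t t≤ → runStart-const c (word col q) (len q) wL t (subst (_≤ t) (sym g≡0) z≤n) t≤)

  firstRunEnd<len : ∀ col c q → word col q 0 ≡ c → Δ col q ≢ 0 → firstRunEnd col c q < len q
  firstRunEnd<len col c q w0 Δ≢0 =
    ≤∧≢⇒< (firstRunEnd≤ col c q) (λ e≡ → Δ≢0 (firstRunEnd≡len⇒Δ≡0 col c q w0 e≡))

  firstRun<lastRun : ∀ col c q → word col q (len q) ≡ c → firstRunEnd col c q < len q →
    suc (firstRunEnd col c q) < lastRunStart col c q
  firstRun<lastRun col c q wL e< with suc (firstRunEnd col c q) <? lastRunStart col c q
  ... | yes 1+e<g = 1+e<g
  ... | no  1+e≮g = ⊥-elim (runEnd-stops c (word col q) 0 (len q) e<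
          (runStart-const c (word col q) (len q) wL _ (≮⇒≥ 1+e≮g) e<))

  bichromatic-edge⇒Δ>0 : ∀ col {x y} → Adj G x y → col x ≢ col y → Σ[ q ∈ Fin m ] 1 ≤ Δ col q
  bichromatic-edge⇒Δ>0 col {x} {y} x-y x≢y with adj-on-path x-y
  ... | q , t , t< , side with Δ col q ≟ 0
  ...   | no  Δ≢0 = q , n≢0⇒n>0 Δ≢0
  ...   | yes Δ≡0 = ⊥-elim (x≢y (along side))
    where
    same : ∀ {y z} → toℕ y ≡ label q t → toℕ z ≡ label q (suc t) → col y ≡ col z
    same {y} {z} y≡ z≡ = trans (sym (word-at col q t y y≡))
      (trans (Δ≡0⇒constant col q Δ≡0 t (<⇒≤ t<))
        (trans (sym (Δ≡0⇒constant col q Δ≡0 (suc t) t<)) (word-at col q (suc t) z z≡)))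
    along : (toℕ x ≡ label q t × toℕ y ≡ label q (suc t)) ⊎ (toℕ x ≡ label q (suc t) × toℕ y ≡ label q t) →
      col x ≡ col y
    along (inj₁ (x≡ , y≡)) = same x≡ y≡
    along (inj₂ (x≡ , y≡)) = sym (same y≡ x≡)

  fused-reachesU⇒V : ∀ col x → ReachesU col x → Fused (Δ col) → ReachesV col x
  fused-reachesU⇒V col x r (inj₁ u≡v) z z≡v = r z (trans z≡v (sym u≡v))
  fused-reachesU⇒V col x r (inj₂ (q , Δ≡0)) z z≡v =
    reaches-up q 0 (len q) z≤n ≤-refl (λ t _ t≤ → trans (Δ≡0⇒constant col q Δ≡0 t t≤) (reachesU-word r q))
      (λ z z≡ → r z (trans z≡ (label-0 q))) z (trans z≡v (sym (label-len q)))

  fused-reachesV⇒U : ∀ col x → ReachesV col x → Fused (Δ col) → ReachesU col x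
  fused-reachesV⇒U col x r (inj₁ u≡v) z z≡u = r z (trans z≡u u≡v)
  fused-reachesV⇒U col x r (inj₂ (q , Δ≡0)) z z≡u =
    reaches-down q 0 (len q) z≤n ≤-refl
      (λ t _ t≤ → trans (Δ≡0⇒constant col q Δ≡0 t t≤)
                    (trans (sym (Δ≡0⇒constant col q Δ≡0 (len q) ≤-refl)) (reachesV-word r q)))
      (λ z z≡ → r z (trans z≡ (label-len q))) z (trans z≡u (sym (label-0 q)))

  module _ {col : Coloring G} {x : V} {p : Fin m} {s : ℕ} (x≡ : toℕ x ≡ label p s) (s< : s < len p) where

    run-to-u : runStart (col x) (word col p) s ≡ 0 → ReachesU col x × (∀ mv → OnEndRuns col x true mv)
    run-to-u start≡0 = ru , λ mv → inj₂ (inj₂ (p , s , <⇒≤ s< , x≡ ,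
      endRuns-first col (col x) mv p s (runEnd-maximal (col x) (word col p) 0 (len p) s (λ t _ t≤s → mono t t≤s) (<⇒≤ s<))))
      where
      mono : ∀ t → t ≤ s → word col p t ≡ col x
      mono t t≤s = runStart-const (col x) (word col p) s (word-at col p s x x≡) t (subst (_≤ t) (sym start≡0) z≤n) t≤s
      ru : ReachesU col x
      ru z z≡u = reaches-down p 0 s z≤n (<⇒≤ s<) (λ t _ t≤s → mono t t≤s) (λ z z≡ → conn-self z (trans z≡ (sym x≡)))
                   z (trans z≡u (sym (label-0 p)))

    run-to-v : ¬ runEnd (col x) (word col p) s (len p ∸ s) < len p → ReachesV col x × (∀ mu → OnEndRuns col x mu true)
    run-to-v end≮ = rv , λ mu → inj₂ (inj₂ (p , s , <⇒≤ s< , x≡ ,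
      endRuns-last col (col x) mu p s (runStart-minimal (col x) (word col p) (len p) s mono (<⇒≤ s<))))
      where
      mono : ∀ t → s ≤ t → t ≤ len p → word col p t ≡ col x
      mono = runEnd-reaches (col x) (word col p) s (len p) (<⇒≤ s<) (word-at col p s x x≡) end≮
      rv : ReachesV col x
      rv z z≡v = reaches-up p s (len p) (<⇒≤ s<) ≤-refl mono (λ z z≡ → conn-self z (trans z≡ (sym x≡)))
                   z (trans z≡v (sym (label-len p)))

  module _ {col col′ : Coloring G} {x : V} {c′ : ℕ} (bin : Binary col) (rec : Recolouring col col′ (col x) c′ x)
    (c′<2 : c′ < 2) (c≢c′ : col x ≢ c′) where

    private
      c : ℕ
      c = col x

    hub-loop-effect : ReachesU col x → ReachesV col x → OnEndRuns col x true true →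
      Binary col′ × (∀ q → Δ col′ q ≡ Δ col q ∸ 2)
    hub-loop-effect ru rv x-on = recolouring-binary rec c′<2 bin , per-path
      where
      open HubComponent col x true true (λ _ → ru) (λ _ → rv) (λ _ _ _ → refl) (λ _ _ _ → refl) (λ _ → refl) x-on
        using (Δ-recolour; recolouring-binary)
      per-path : ∀ q → Δ col′ q ≡ Δ col q ∸ 2
      per-path q = by-first-run (firstRunEnd col c q ≟ len q)
        where
        after-runs : ∀ g → lastRunStart col c q ≡ g → suc (firstRunEnd col c q) < g → Δ col′ q ≡ Δ col q ∸ 2
        after-runs (suc g) g≡ (s≤s e<g) = trans (sym (m+n∸n≡m _ 2)) (cong (_∸ 2)
          (trans (cong (Δ col′ q +_) (sym (cuts-both-runs col c q g e<g g≡))) (Δ-recolour rec bin (bin x) c′<2 c≢c′ q)))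
        by-first-run : Dec (firstRunEnd col c q ≡ len q) → Δ col′ q ≡ Δ col q ∸ 2
        by-first-run (yes e≡) = begin
          Δ col′ q                                                ≡⟨ sym (+-identityʳ _) ⟩
          Δ col′ q + 0                                            ≡⟨ cong (Δ col′ q +_) (sym (cuts-whole-run col c q e≡)) ⟩
          Δ col′ q + cuts (endRuns col c true true q) (len q)     ≡⟨ Δ-recolour rec bin (bin x) c′<2 c≢c′ q ⟩
          Δ col q                                                 ≡⟨ Δ≡0 ⟩
          0                                                       ≡⟨ cong (_∸ 2) (sym Δ≡0) ⟩
          Δ col q ∸ 2                                             ∎
          where
          Δ≡0 : Δ col q ≡ 0
          Δ≡0 = firstRunEnd≡len⇒Δ≡0 col c q (reachesU-word ru q) e≡
        by-first-run (no e≢) = after-runs (lastRunStart col c q) refl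
          (firstRun<lastRun col c q (reachesV-word rv q) (≤∧≢⇒< (firstRunEnd≤ col c q) e≢))

    hub-θ-effect-u : ReachesU col x → OnEndRuns col x true false → u ≢ v → (∀ q → Δ col q ≢ 0) →
      Binary col′ × (∀ q → Δ col′ q + 1 ≡ Δ col q)
    hub-θ-effect-u ru x-on u≢v Δ≢0 = recolouring-binary rec c′<2 bin , per-path
      where
      first-run-short : ∀ q → firstRunEnd col c q < len q
      first-run-short q = firstRunEnd<len col c q (reachesU-word ru q) (Δ≢0 q)
      open HubComponent col x true false (λ _ → ru) (λ ()) (λ ())
        (λ _ q e≡ → ⊥-elim (<-irrefl e≡ (first-run-short q))) (λ u≡v → ⊥-elim (u≢v u≡v)) x-on
        using (Δ-recolour; recolouring-binary)
      per-path : ∀ q → Δ col′ q + 1 ≡ Δ col q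
      per-path q = trans (cong (Δ col′ q +_) (sym (cuts-first-run col c q (first-run-short q))))
                         (Δ-recolour rec bin (bin x) c′<2 c≢c′ q)

    hub-θ-effect-v : ReachesV col x → OnEndRuns col x false true → u ≢ v → (∀ q → Δ col q ≢ 0) →
      Binary col′ × (∀ q → Δ col′ q + 1 ≡ Δ col q)
    hub-θ-effect-v rv x-on u≢v Δ≢0 = recolouring-binary rec c′<2 bin , per-path
      where
      last-run-short : ∀ q → lastRunStart col c q ≢ 0
      last-run-short q g≡0 = Δ≢0 q (lastRunStart≡0⇒Δ≡0 col c q (reachesV-word rv q) g≡0)
      open HubComponent col x false true (λ ()) (λ _ → rv) (λ _ q g≡0 → ⊥-elim (last-run-short q g≡0)) (λ ())
        (λ u≡v → ⊥-elim (u≢v u≡v)) x-on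
        using (Δ-recolour; recolouring-binary)
      last-run : ∀ q g → lastRunStart col c q ≡ g → Δ col′ q + 1 ≡ Δ col q
      last-run q zero    g≡0 = ⊥-elim (last-run-short q g≡0)
      last-run q (suc g) g≡  = trans (cong (Δ col′ q +_) (sym (cuts-last-run col c q g g≡)))
                                     (Δ-recolour rec bin (bin x) c′<2 c≢c′ q)
      per-path : ∀ q → Δ col′ q + 1 ≡ Δ col q
      per-path q = last-run q (lastRunStart col c q) refl

    interior-effect : ∀ p s → toℕ x ≡ label p s → s ≤ len p → ∀ a → runStart c (word col p) s ≡ suc a →
      runEnd c (word col p) s (len p ∸ s) < len p → Binary col′ × ΔStep (Δ col) (Δ col′)
    interior-effect p s x≡ s≤ a start≡ end< =
      recolouring-binary rec c′<2 bin , inside p (Δ-interior rec bin c′<2 c≢c′) (Δ-elsewhere rec bin c′<2 c≢c′)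
      where
      open InteriorComponent col p s x x≡ s≤ a start≡ end<

    module _ (nz : Σ[ q ∈ Fin m ] 1 ≤ Δ col q) where

      unfused-θ : ¬ Fused (Δ col) → (∀ q → Δ col′ q + 1 ≡ Δ col q) → ΔStep (Δ col) (Δ col′)
      unfused-θ ¬fused = hub-θ (¬fused ∘ inj₁) (λ q → n≢0⇒n>0 (λ Δ≡0 → ¬fused (inj₂ (q , Δ≡0)))) (proj₁ nz)

      via-u : ReachesU col x → (∀ mv → OnEndRuns col x true mv) → Binary col′ × ΔStep (Δ col) (Δ col′)
      via-u ru x-on with fused? (Δ col)
      ... | yes fused = map₂ (hub-loop fused nz) (hub-loop-effect ru (fused-reachesU⇒V col x ru fused) (x-on true))
      ... | no ¬fused = map₂ (unfused-θ ¬fused)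
                             (hub-θ-effect-u ru (x-on false) (¬fused ∘ inj₁) (λ q Δ≡0 → ¬fused (inj₂ (q , Δ≡0))))

      via-v : ReachesV col x → (∀ mu → OnEndRuns col x mu true) → Binary col′ × ΔStep (Δ col) (Δ col′)
      via-v rv x-on with fused? (Δ col)
      ... | yes fused = map₂ (hub-loop fused nz) (hub-loop-effect (fused-reachesV⇒U col x rv fused) rv (x-on true))
      ... | no ¬fused = map₂ (unfused-θ ¬fused)
                             (hub-θ-effect-v rv (x-on false) (¬fused ∘ inj₁) (λ q Δ≡0 → ¬fused (inj₂ (q , Δ≡0))))

      effect-at : Location (toℕ x) → Binary col′ × ΔStep (Δ col) (Δ col′)
      effect-at (inj₁ x≡u) = via-u (λ z z≡ → conn-self z (trans z≡ (sym x≡u))) (λ _ → inj₁ (x≡u , refl))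
      effect-at (inj₂ (inj₁ x≡v)) =
        via-v (λ z z≡ → conn-self z (trans z≡ (sym x≡v))) (λ _ → inj₂ (inj₁ (x≡v , refl)))
      effect-at (inj₂ (inj₂ (p , s , _ , s< , x≡))) = by-run-start (runStart c (word col p) s) refl
        where
        by-run-start : ∀ r → runStart c (word col p) s ≡ r → Binary col′ × ΔStep (Δ col) (Δ col′)
        by-run-start zero    start≡0 = uncurry via-u (run-to-u x≡ s< start≡0)
        by-run-start (suc a) start≡ with runEnd c (word col p) s (len p ∸ s) <? len p
        ... | yes end< = interior-effect p s x≡ (<⇒≤ s<) a start≡ end<
        ... | no  end≮ = uncurry via-v (run-to-v x≡ s< end≮)

  move-effect : ∀ {col col′} → Binary col → Move G col col′ → Binary col′ × ΔStep (Δ col) (Δ col′)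
  move-effect {col} bin (x , c′ , c′≢c , (w , x-w , w≡c′) , rec) =
    effect-at bin rec c′<2 c≢c′ (bichromatic-edge⇒Δ>0 col x-w (λ e → c≢c′ (trans e w≡c′))) (locate x)
    where
    c′<2 : c′ < 2
    c′<2 = subst (_< 2) w≡c′ (bin w)
    c≢c′ : col x ≢ c′
    c≢c′ e = c′≢c (sym e)

  MoveWith : Coloring G → (Coloring G → Set) → Set
  MoveWith col R = Σ[ col′ ∈ Coloring G ] Move G col col′ × Binary col′ × R col′

  -- Recolour the run just after the initial run of path p with the colour of the initial run.
  module SecondRun (col : Coloring G) (p : Fin m) (Δ≥2 : 2 ≤ Δ col p) where
    w : ℕ → ℕ
    w = word col p
    c₀ : ℕ
    c₀ = w 0
    e : ℕ
    e = firstRunEnd col c₀ p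

    e< : e < len p
    e< = firstRunEnd<len col c₀ p refl (λ Δ≡0 → <-irrefl (sym Δ≡0) (≤-trans (s≤s z≤n) Δ≥2))

    x : V
    x = vertexAt p (suc e) e<
    x≡ : toℕ x ≡ label p (suc e)
    x≡ = vertexAt-label p (suc e) e<

    w-e : w e ≡ c₀
    w-e = runEnd-const c₀ w 0 (len p) refl e z≤n ≤-refl

    x≢c₀ : col x ≢ c₀
    x≢c₀ x≡c₀ = runEnd-stops c₀ w 0 (len p) e< (trans (word-at col p (suc e) x x≡) x≡c₀)

    start≡ : runStart (col x) w (suc e) ≡ suc e
    start≡ = runStart-after-switch (col x) w e (λ w≡ → x≢c₀ (trans (sym w≡) w-e))

    end< : runEnd (col x) w (suc e) (len p ∸ suc e) < len p
    end< with runEnd (col x) w (suc e) (len p ∸ suc e) <? len p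
    ... | yes end< = end<
    ... | no  end≮ = ⊥-elim (<-irrefl (sym Δ≡1) Δ≥2)
      where
      Δ≡1 : Δ col p ≡ 1
      Δ≡1 = changes-single-switch w (len p) e e< (λ c₀≡ → x≢c₀ (sym c₀≡))
              (λ t t≤e → runEnd-const c₀ w 0 (len p) refl t z≤n t≤e)
              (runEnd-reaches (col x) w (suc e) (len p) e< (word-at col p (suc e) x x≡) end≮)

    open InteriorComponent col p (suc e) x x≡ e< e start≡ end<
      using (recolour; recolour-is-recolouring; recolouring-binary; Δ-interior; Δ-elsewhere) public

    y : V
    y = vertexAt p e (<⇒≤ e<)

    x-y : Adj G x y
    x-y = adj-sym (adj-along p e e< y x (vertexAt-label p e (<⇒≤ e<)) x≡)

    y≡c₀ : col y ≡ c₀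
    y≡c₀ = trans (sym (word-at col p e y (vertexAt-label p e (<⇒≤ e<)))) w-e

  interior-move : ∀ col → Binary col → ∀ p → 2 ≤ Δ col p →
    MoveWith col (λ col′ → Δ col′ p + 2 ≡ Δ col p × (∀ q → q ≢ p → Δ col′ q ≡ Δ col q))
  interior-move col bin p Δ≥2 =
    recolour c₀ , (x , c₀ , (λ c₀≡ → x≢c₀ (sym c₀≡)) , (y , x-y , y≡c₀) , rec) ,
    recolouring-binary rec c₀<2 bin , Δ-interior rec bin c₀<2 x≢c₀ , Δ-elsewhere rec bin c₀<2 x≢c₀
    where
    open SecondRun col p Δ≥2
    rec : Recolouring col (recolour c₀) (col x) c₀ x
    rec = recolour-is-recolouring c₀
    c₀<2 : c₀ < 2
    c₀<2 = subst (_< 2) y≡c₀ (bin y)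

  -- The edge leaving the initial run of a non-monochromatic path q.
  module FirstRunEdge (col : Coloring G) (q : Fin m) (Δ≢0 : Δ col q ≢ 0) where
    w : ℕ → ℕ
    w = word col q
    c : ℕ
    c = w 0
    e : ℕ
    e = firstRunEnd col c q

    e< : e < len q
    e< = firstRunEnd<len col c q refl Δ≢0

    x : V
    x = vertexAt q e (<⇒≤ e<)
    x≡ : toℕ x ≡ label q e
    x≡ = vertexAt-label q e (<⇒≤ e<)
    y : V
    y = vertexAt q (suc e) e<
    y≡ : toℕ y ≡ label q (suc e)
    y≡ = vertexAt-label q (suc e) e<

    run : ∀ t → t ≤ e → w t ≡ c
    run t t≤e = runEnd-const c w 0 (len q) refl t z≤n t≤e

    x≡c : col x ≡ c
    x≡c = trans (sym (word-at col q e x x≡)) (run e ≤-refl)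

    x≢y : col x ≢ col y
    x≢y x≡y = runEnd-stops c w 0 (len q) e< (trans (word-at col q (suc e) y y≡) (trans (sym x≡y) x≡c))

    x-y : Adj G x y
    x-y = adj-along q e e< x y x≡ y≡

    ru : ReachesU col x
    ru z z≡u = reaches-down q 0 e z≤n (<⇒≤ e<) (λ t _ t≤e → trans (run t t≤e) (sym x≡c))
                 (λ z z≡ → conn-self z (trans z≡ (sym x≡))) z (trans z≡u (sym (label-0 q)))

    x-on : ∀ mv → OnEndRuns col x true mv
    x-on mv = inj₂ (inj₂ (q , e , <⇒≤ e< , x≡ , endRuns-first col (col x) mv q e
      (runEnd-maximal (col x) w 0 (len q) e (λ t _ t≤e → trans (run t t≤e) (sym x≡c)) (<⇒≤ e<))))

  hub-θ-move : ∀ col → Binary col → u ≢ v → (∀ q → Δ col q ≢ 0) → Fin m →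
    MoveWith col (λ col′ → ∀ q → Δ col′ q + 1 ≡ Δ col q)
  hub-θ-move col bin u≢v Δ≢0 q₀ =
    recolour (col y) , (x , col y , (λ y≡x → x≢y (sym y≡x)) , (y , x-y , refl) , rec) ,
    hub-θ-effect-u bin rec (bin y) x≢y ru (x-on false) u≢v Δ≢0
    where
    open FirstRunEdge col q₀ (Δ≢0 q₀)
    open HubComponent col x true false (λ _ → ru) (λ ()) (λ ())
      (λ _ q e≡ → ⊥-elim (Δ≢0 q (firstRunEnd≡len⇒Δ≡0 col (col x) q (reachesU-word ru q) e≡)))
      (λ u≡v → ⊥-elim (u≢v u≡v)) (x-on false)
      using (recolour; recolour-is-recolouring)
    rec : Recolouring col (recolour (col y)) (col x) (col y) x
    rec = recolour-is-recolouring (col y)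

  hub-loop-move : ∀ col → Binary col → Fused (Δ col) → (Σ[ q ∈ Fin m ] 1 ≤ Δ col q) →
    MoveWith col (λ col′ → ∀ q → Δ col′ q ≡ Δ col q ∸ 2)
  hub-loop-move col bin fused (q₀ , Δ≥1) =
    recolour (col y) , (x , col y , (λ y≡x → x≢y (sym y≡x)) , (y , x-y , refl) , rec) ,
    hub-loop-effect bin rec (bin y) x≢y ru rv (x-on true)
    where
    open FirstRunEdge col q₀ (λ Δ≡0 → <-irrefl (sym Δ≡0) Δ≥1)
    rv : ReachesV col x
    rv = fused-reachesU⇒V col x ru fused
    open HubComponent col x true true (λ _ → ru) (λ _ → rv) (λ _ _ _ → refl) (λ _ _ _ → refl) (λ _ → refl) (x-on true)
      using (recolour; recolour-is-recolouring)
    rec : Recolouring col (recolour (col y)) (col x) (col y) x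
    rec = recolour-is-recolouring (col y)

count : ∀ {k} → (Fin k → ℕ) → ℕ → ℕ
count {zero}  d v = 0
count {suc k} d v = δ v (d fzero) + count (d ∘ fsuc) v

count-cong : ∀ {k} {d d′ : Fin k → ℕ} v → (∀ q → d q ≡ d′ q) → count d v ≡ count d′ v
count-cong {zero}  v _ = refl
count-cong {suc k} v h = cong₂ _+_ (cong (δ v) (h fzero)) (count-cong v (h ∘ fsuc))

count-transport : ∀ {k} (d d′ : Fin k → ℕ) v v′ → (∀ q → δ v (d′ q) ≡ δ v′ (d q)) → count d′ v ≡ count d v′
count-transport {zero}  d d′ v v′ _ = refl
count-transport {suc k} d d′ v v′ h = cong₂ _+_ (h fzero) (count-transport (d ∘ fsuc) (d′ ∘ fsuc) v v′ (h ∘ fsuc))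

count-update : ∀ {k} (d d′ : Fin k → ℕ) p v → (∀ q → q ≢ p → d′ q ≡ d q) →
  count d′ v + δ v (d p) ≡ count d v + δ v (d′ p)
count-update {suc k} d d′ fzero v others
  rewrite count-cong {d = d′ ∘ fsuc} {d ∘ fsuc} v (λ q → others (fsuc q) (λ ()))
  = trans (+-assoc (δ v (d′ fzero)) _ _) (trans (+-comm (δ v (d′ fzero)) _) (cong (_+ δ v (d′ fzero)) (+-comm _ (δ v (d fzero)))))
count-update {suc k} d d′ (fsuc p) v others rewrite others fzero (λ ()) =
  trans (+-assoc (δ v (d fzero)) _ _)
    (trans (cong (δ v (d fzero) +_)
             (count-update (d ∘ fsuc) (d′ ∘ fsuc) p v (λ q q≢p → others (fsuc q) (q≢p ∘ fsuc-injective))))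
           (sym (+-assoc (δ v (d fzero)) _ _)))

count>0⇒∃ : ∀ {k} (d : Fin k → ℕ) v {n} → count d v ≡ suc n → Σ[ q ∈ Fin k ] d q ≡ v
count>0⇒∃ {suc k} d v h with d fzero ≡ᵇ v in e
... | true  = fzero , ≡ᵇ-true⁻¹ e
... | false with count>0⇒∃ (d ∘ fsuc) v h
...   | q , d≡ = fsuc q , d≡

∃⇒count>0 : ∀ {k} (d : Fin k → ℕ) {v} q → d q ≡ v → Σ[ n ∈ ℕ ] count d v ≡ suc n
∃⇒count>0 {suc k} d {v} fzero    refl rewrite δ-refl (d fzero) = count (d ∘ fsuc) v , refl
∃⇒count>0 {suc k} d {v} (fsuc q) d≡ with ∃⇒count>0 (d ∘ fsuc) q d≡
... | n , c≡ = δ v (d fzero) + n , trans (cong (δ v (d fzero) +_) c≡) (+-suc _ n)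

count-absent : ∀ {k} (d : Fin k → ℕ) v → (∀ q → d q ≢ v) → count d v ≡ 0
count-absent {zero}  d v _ = refl
count-absent {suc k} d v h rewrite δ-≢ (h fzero) = count-absent (d ∘ fsuc) v (h ∘ fsuc)

count-pred : ∀ {k} (d d′ : Fin k → ℕ) → (∀ q → d′ q + 1 ≡ d q) → ∀ v → count d′ v ≡ count d (suc v)
count-pred d d′ h v = count-transport d d′ v (suc v) (λ q → cong (δ (suc v)) (trans (+-comm 1 (d′ q)) (h q)))

count-∸2 : ∀ {k} (d d′ : Fin k → ℕ) → (∀ q → d′ q ≡ d q ∸ 2) → ∀ v → count d′ (suc v) ≡ count d (3 + v)
count-∸2 d d′ h v = count-transport d d′ (suc v) (3 + v) (λ q → trans (cong (δ (suc v)) (h q)) (δ-∸2 (d q)))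
  where
  δ-∸2 : ∀ x → δ (suc v) (x ∸ 2) ≡ δ (3 + v) x
  δ-∸2 zero          = refl
  δ-∸2 (suc zero)    = refl
  δ-∸2 (suc (suc x)) = refl

module Lowering {k} {d d′ : Fin k → ℕ} {p : Fin k} {x : ℕ}
  (d≡ : d p ≡ suc (suc x)) (d′≡ : d′ p ≡ x) (others : ∀ q → q ≢ p → d′ q ≡ d q) where

  update : ∀ v → count d′ v + δ v (suc (suc x)) ≡ count d v + δ v x
  update v = subst₂ (λ a b → count d′ v + δ v a ≡ count d v + δ v b) d≡ d′≡ (count-update d d′ p v others)

  x≢x+2 : x ≢ suc (suc x)
  x≢x+2 e = <-irrefl e (m<n⇒m<1+n ≤-refl)

  count-from : ∀ {n} → count d (suc (suc x)) ≡ suc n → count d′ (suc (suc x)) ≡ n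
  count-from {n} c≡ = suc-injective (begin
    suc (count d′ (suc (suc x)))                          ≡⟨ +-comm 1 _ ⟩
    count d′ (suc (suc x)) + 1                            ≡⟨ cong (count d′ (suc (suc x)) +_) (sym (δ-refl (suc (suc x)))) ⟩
    count d′ (suc (suc x)) + δ (suc (suc x)) (suc (suc x)) ≡⟨ update (suc (suc x)) ⟩
    count d (suc (suc x)) + δ (suc (suc x)) x             ≡⟨ cong (count d (suc (suc x)) +_) (δ-≢ x≢x+2) ⟩
    count d (suc (suc x)) + 0                             ≡⟨ +-identityʳ _ ⟩
    count d (suc (suc x))                                 ≡⟨ c≡ ⟩
    suc n                                                 ∎)

  count-to : ∀ {n} → count d x ≡ n → count d′ x ≡ suc n
  count-to {n} refl = begin
    count d′ x                           ≡⟨ sym (+-identityʳ _) ⟩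
    count d′ x + 0                       ≡⟨ cong (count d′ x +_) (sym (δ-≢ (x≢x+2 ∘ sym))) ⟩
    count d′ x + δ x (suc (suc x))       ≡⟨ update x ⟩
    count d x + δ x x                    ≡⟨ cong (count d x +_) (δ-refl x) ⟩
    count d x + 1                        ≡⟨ +-comm _ 1 ⟩
    suc (count d x)                      ∎

  count-other : ∀ v {n} → v ≢ x → v ≢ suc (suc x) → count d v ≡ n → count d′ v ≡ n
  count-other v {n} v≢x v≢x+2 refl = begin
    count d′ v                           ≡⟨ sym (+-identityʳ _) ⟩
    count d′ v + 0                       ≡⟨ cong (count d′ v +_) (sym (δ-≢ (v≢x+2 ∘ sym))) ⟩
    count d′ v + δ v (suc (suc x))       ≡⟨ update v ⟩
    count d v + δ v x                    ≡⟨ cong (count d v +_) (δ-≢ (v≢x ∘ sym)) ⟩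
    count d v + 0                        ≡⟨ +-identityʳ _ ⟩
    count d v                            ∎

  values : ∀ (Q : ℕ → Set) → Q x → (∀ q → Q (d q)) → ∀ q → Q (d′ q)
  values Q Qx Qd q with q ≟ᶠ p
  ... | yes refl = subst Q (sym d′≡) Qx
  ... | no  q≢p  = subst Q (sym (others q q≢p)) (Qd q)

data Value : Shape → ℕ → Set where
  loop0 : Value loop 0
  loop2 : Value loop 2
  loop4 : Value loop 4
  loop6 : Value loop 6
  even2 : Value evenθ 2
  even4 : Value evenθ 4
  even6 : Value evenθ 6
  odd1  : Value oddθ 1
  odd3  : Value oddθ 3
  odd5  : Value oddθ 5

even⇒loop : ∀ {x} → Value evenθ x → Value loop x
even⇒loop even2 = loop2
even⇒loop even4 = loop4
even⇒loop even6 = loop6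

m+1≡1+n⇒m≡n : ∀ {y x} → y + 1 ≡ suc x → y ≡ x
m+1≡1+n⇒m≡n {y} h = suc-injective (trans (+-comm 1 y) h)

even-pred : ∀ {x y} → y + 1 ≡ x → Value evenθ x → Value oddθ y
even-pred h even2 = subst (Value oddθ) (sym (m+1≡1+n⇒m≡n h)) odd1
even-pred h even4 = subst (Value oddθ) (sym (m+1≡1+n⇒m≡n h)) odd3
even-pred h even6 = subst (Value oddθ) (sym (m+1≡1+n⇒m≡n h)) odd5

odd-pred : ∀ {x y} → y + 1 ≡ x → Value oddθ x → x ≢ 1 → Value evenθ y
odd-pred h odd1 x≢1 = ⊥-elim (x≢1 refl)
odd-pred h odd3 _   = subst (Value evenθ) (sym (m+1≡1+n⇒m≡n h)) even2
odd-pred h odd5 _   = subst (Value evenθ) (sym (m+1≡1+n⇒m≡n h)) even4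

odd-pred-loop : ∀ {x y} → y + 1 ≡ x → Value oddθ x → Value loop y
odd-pred-loop h odd1 = subst (Value loop) (sym (m+1≡1+n⇒m≡n h)) loop0
odd-pred-loop h odd3 = subst (Value loop) (sym (m+1≡1+n⇒m≡n h)) loop2
odd-pred-loop h odd5 = subst (Value loop) (sym (m+1≡1+n⇒m≡n h)) loop4

odd≢7 : ∀ {x} → Value oddθ x → x ≢ 7
odd≢7 odd1 ()
odd≢7 odd3 ()
odd≢7 odd5 ()

loop-∸2 : ∀ {x} → Value loop x → Value loop (x ∸ 2)
loop-∸2 loop0 = loop0
loop-∸2 loop2 = loop0
loop-∸2 loop4 = loop2
loop-∸2 loop6 = loop4

loop-∸2≢6 : ∀ {x} → Value loop x → x ∸ 2 ≢ 6
loop-∸2≢6 loop0 ()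
loop-∸2≢6 loop2 ()
loop-∸2≢6 loop4 ()
loop-∸2≢6 loop6 ()

level : Shape → ℕ
level loop  = 2
level evenθ = 2
level oddθ  = 1

level≥1 : ∀ s → 1 ≤ level s
level≥1 loop  = s≤s z≤n
level≥1 evenθ = s≤s z≤n
level≥1 oddθ  = s≤s z≤n

module Simulation (P : PathSystem) where
  open PathSystem P
  open Colourings P
  open MoveEffects P

  HubCondition : Shape → (Fin m → ℕ) → Set
  HubCondition loop  d = Fused d
  HubCondition evenθ _ = u ≢ v
  HubCondition oddθ  _ = u ≢ v

  -- d stands for Δ col, the numbers of colour changes along the paths.
  Realises : (Fin m → ℕ) → AState → Set
  Realises d (st s a b c) = HubCondition s d × (∀ q → Value s (d q))
    × count d (level s) ≡ a × count d (2 + level s) ≡ b × count d (4 + level s) ≡ c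

  count-positive : ∀ {d : Fin m → ℕ} {v n} q → count d v ≡ n → d q ≡ v → Σ[ n′ ∈ ℕ ] n ≡ suc n′
  count-positive {d} q c≡ d≡ with ∃⇒count>0 d q d≡
  ... | n′ , c≡′ = n′ , trans (sym c≡) c≡′

  notAllZero-at : ∀ {d s a b c} → Realises d (st s a b c) → ∀ q {x} → d q ≡ x → Value s x → 1 ≤ x → NotAllZero a b c
  notAllZero-at (_ , _ , ca , cb , cc) q d≡ loop2 _ = nz₁′ (count-positive q ca d≡)
  notAllZero-at (_ , _ , ca , cb , cc) q d≡ loop4 _ = nz₂′ (count-positive q cb d≡)
  notAllZero-at (_ , _ , ca , cb , cc) q d≡ loop6 _ = nz₃′ (count-positive q cc d≡)
  notAllZero-at (_ , _ , ca , cb , cc) q d≡ even2 _ = nz₁′ (count-positive q ca d≡)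
  notAllZero-at (_ , _ , ca , cb , cc) q d≡ even4 _ = nz₂′ (count-positive q cb d≡)
  notAllZero-at (_ , _ , ca , cb , cc) q d≡ even6 _ = nz₃′ (count-positive q cc d≡)
  notAllZero-at (_ , _ , ca , cb , cc) q d≡ odd1  _ = nz₁′ (count-positive q ca d≡)
  notAllZero-at (_ , _ , ca , cb , cc) q d≡ odd3  _ = nz₂′ (count-positive q cb d≡)
  notAllZero-at (_ , _ , ca , cb , cc) q d≡ odd5  _ = nz₃′ (count-positive q cc d≡)

  fused-lower : ∀ {d d′ : Fin m → ℕ} {p} → Fused d → d p ≢ 0 → (∀ q → q ≢ p → d′ q ≡ d q) → Fused d′
  fused-lower (inj₁ u≡v) _ _ = inj₁ u≡v
  fused-lower {p = p} (inj₂ (q , d≡0)) d≢0 others with q ≟ᶠ p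
  ... | yes refl = ⊥-elim (d≢0 d≡0)
  ... | no  q≢p  = inj₂ (q , trans (others q q≢p) d≡0)

  module _ {d d′ : Fin m → ℕ} {p : Fin m} where

    lower-loop-a : ∀ {a b c} → Realises d (st loop (suc a) b c) → d p ≡ 2 → d′ p ≡ 0 →
      (∀ q → q ≢ p → d′ q ≡ d q) → Realises d′ (st loop a b c)
    lower-loop-a (_ , vals , ca , cb , cc) d≡ d′≡ others =
      inj₂ (p , d′≡) , values (Value loop) loop0 vals ,
      count-from ca , count-other 4 (λ ()) (λ ()) cb , count-other 6 (λ ()) (λ ()) cc
      where open Lowering d≡ d′≡ others

    lower-loop-b : ∀ {a b c} → Realises d (st loop a (suc b) c) → d p ≡ 4 → d′ p ≡ 2 →
      (∀ q → q ≢ p → d′ q ≡ d q) → Realises d′ (st loop (suc a) b c)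
    lower-loop-b (fused , vals , ca , cb , cc) d≡ d′≡ others =
      fused-lower fused (λ d≡0 → 1+n≢0 (trans (sym d≡) d≡0)) others , values (Value loop) loop2 vals ,
      count-to ca , count-from cb , count-other 6 (λ ()) (λ ()) cc
      where open Lowering d≡ d′≡ others

    lower-loop-c : ∀ {a b c} → Realises d (st loop a b (suc c)) → d p ≡ 6 → d′ p ≡ 4 →
      (∀ q → q ≢ p → d′ q ≡ d q) → Realises d′ (st loop a (suc b) c)
    lower-loop-c (fused , vals , ca , cb , cc) d≡ d′≡ others =
      fused-lower fused (λ d≡0 → 1+n≢0 (trans (sym d≡) d≡0)) others , values (Value loop) loop4 vals ,
      count-other 2 (λ ()) (λ ()) ca , count-to cb , count-from cc
      where open Lowering d≡ d′≡ others

    lower-even-a : ∀ {a b c} → Realises d (st evenθ (suc a) b c) → d p ≡ 2 → d′ p ≡ 0 →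
      (∀ q → q ≢ p → d′ q ≡ d q) → Realises d′ (st loop a b c)
    lower-even-a (_ , vals , ca , cb , cc) d≡ d′≡ others =
      inj₂ (p , d′≡) , values (Value loop) loop0 (even⇒loop ∘ vals) ,
      count-from ca , count-other 4 (λ ()) (λ ()) cb , count-other 6 (λ ()) (λ ()) cc
      where open Lowering d≡ d′≡ others

    lower-even-b : ∀ {a b c} → Realises d (st evenθ a (suc b) c) → d p ≡ 4 → d′ p ≡ 2 →
      (∀ q → q ≢ p → d′ q ≡ d q) → Realises d′ (st evenθ (suc a) b c)
    lower-even-b (u≢v , vals , ca , cb , cc) d≡ d′≡ others =
      u≢v , values (Value evenθ) even2 vals , count-to ca , count-from cb , count-other 6 (λ ()) (λ ()) cc
      where open Lowering d≡ d′≡ others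

    lower-even-c : ∀ {a b c} → Realises d (st evenθ a b (suc c)) → d p ≡ 6 → d′ p ≡ 4 →
      (∀ q → q ≢ p → d′ q ≡ d q) → Realises d′ (st evenθ a (suc b) c)
    lower-even-c (u≢v , vals , ca , cb , cc) d≡ d′≡ others =
      u≢v , values (Value evenθ) even4 vals , count-other 2 (λ ()) (λ ()) ca , count-to cb , count-from cc
      where open Lowering d≡ d′≡ others

    lower-odd-b : ∀ {a b c} → Realises d (st oddθ a (suc b) c) → d p ≡ 3 → d′ p ≡ 1 →
      (∀ q → q ≢ p → d′ q ≡ d q) → Realises d′ (st oddθ (suc a) b c)
    lower-odd-b (u≢v , vals , ca , cb , cc) d≡ d′≡ others =
      u≢v , values (Value oddθ) odd1 vals , count-to ca , count-from cb , count-other 5 (λ ()) (λ ()) cc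
      where open Lowering d≡ d′≡ others

    lower-odd-c : ∀ {a b c} → Realises d (st oddθ a b (suc c)) → d p ≡ 5 → d′ p ≡ 3 →
      (∀ q → q ≢ p → d′ q ≡ d q) → Realises d′ (st oddθ a (suc b) c)
    lower-odd-c (u≢v , vals , ca , cb , cc) d≡ d′≡ others =
      u≢v , values (Value oddθ) odd3 vals , count-other 1 (λ ()) (λ ()) ca , count-to cb , count-from cc
      where open Lowering d≡ d′≡ others

  module _ {d d′ : Fin m → ℕ} where

    lower-loop-hub : ∀ {a b c} → Realises d (st loop a b c) → (∀ q → d′ q ≡ d q ∸ 2) → Realises d′ (st loop b c 0)
    lower-loop-hub (fused , vals , _ , cb , cc) d′≡ =
      fused′ fused , (λ q → subst (Value loop) (sym (d′≡ q)) (loop-∸2 (vals q))) ,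
      trans (count-∸2 d d′ d′≡ 1) cb , trans (count-∸2 d d′ d′≡ 3) cc ,
      count-absent d′ 6 (λ q d′≡6 → loop-∸2≢6 (vals q) (trans (sym (d′≡ q)) d′≡6))
      where
      fused′ : Fused d → Fused d′
      fused′ (inj₁ u≡v)       = inj₁ u≡v
      fused′ (inj₂ (q , d≡0)) = inj₂ (q , trans (d′≡ q) (cong (_∸ 2) d≡0))

    lower-even-hub : ∀ {a b c} → Realises d (st evenθ a b c) → (∀ q → d′ q + 1 ≡ d q) → Realises d′ (st oddθ a b c)
    lower-even-hub (u≢v , vals , ca , cb , cc) d′≡ =
      u≢v , (λ q → even-pred (d′≡ q) (vals q)) ,
      trans (count-pred d d′ d′≡ 1) ca , trans (count-pred d d′ d′≡ 3) cb , trans (count-pred d d′ d′≡ 5) cc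

    lower-odd-hub₀ : ∀ {b c} → Realises d (st oddθ 0 b c) → (∀ q → d′ q + 1 ≡ d q) → Realises d′ (st evenθ b c 0)
    lower-odd-hub₀ (u≢v , vals , ca , cb , cc) d′≡ =
      u≢v , (λ q → odd-pred (d′≡ q) (vals q) (no-1 q)) ,
      trans (count-pred d d′ d′≡ 2) cb , trans (count-pred d d′ d′≡ 4) cc ,
      trans (count-pred d d′ d′≡ 6) (count-absent d 7 (odd≢7 ∘ vals))
      where
      no-1 : ∀ q → d q ≢ 1
      no-1 q d≡1 with count-positive q ca d≡1
      ... | _ , ()

    lower-odd-hub₁ : ∀ {a b c} → Realises d (st oddθ (suc a) b c) → (∀ q → d′ q + 1 ≡ d q) →
      Realises d′ (st loop b c 0)
    lower-odd-hub₁ (_ , vals , ca , cb , cc) d′≡ =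
      inj₂ (q₁ , m+1≡1+n⇒m≡n (trans (d′≡ q₁) d≡1)) , (λ q → odd-pred-loop (d′≡ q) (vals q)) ,
      trans (count-pred d d′ d′≡ 2) cb , trans (count-pred d d′ d′≡ 4) cc ,
      trans (count-pred d d′ d′≡ 6) (count-absent d 7 (odd≢7 ∘ vals))
      where
      q₁ : Fin m
      q₁ = proj₁ (count>0⇒∃ d 1 ca)
      d≡1 : d q₁ ≡ 1
      d≡1 = proj₂ (count>0⇒∃ d 1 ca)

  nonzero-values : ∀ {s d} → HubCondition s d → (∀ q → Value s (d q)) → s ≢ loop → ∀ q → d q ≢ 0
  nonzero-values {loop}  _ _    s≢loop _ _   = s≢loop refl
  nonzero-values {evenθ} _ vals _      q d≡0 with vals q
  ... | v rewrite d≡0 with v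
  ...   | ()
  nonzero-values {oddθ}  _ vals _      q d≡0 with vals q
  ... | v rewrite d≡0 with v
  ...   | ()

  abstract-inside : ∀ {d d′ p s a b c} y → d p ≡ suc (suc y) → d′ p ≡ y → (∀ q → q ≢ p → d′ q ≡ d q) →
    Realises d (st s a b c) → Value s (suc (suc y)) → Σ[ s′ ∈ AState ] AMove (st s a b c) s′ × Realises d′ s′
  abstract-inside _ d≡ d′≡ others R@(_ , _ , ca , _ , _) loop2 with count-positive _ ca d≡
  ... | _ , refl = _ , loop-a , lower-loop-a R d≡ d′≡ others
  abstract-inside _ d≡ d′≡ others R@(_ , _ , _ , cb , _) loop4 with count-positive _ cb d≡
  ... | _ , refl = _ , loop-b , lower-loop-b R d≡ d′≡ others
  abstract-inside _ d≡ d′≡ others R@(_ , _ , _ , _ , cc) loop6 with count-positive _ cc d≡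
  ... | _ , refl = _ , loop-c , lower-loop-c R d≡ d′≡ others
  abstract-inside _ d≡ d′≡ others R@(_ , _ , ca , _ , _) even2 with count-positive _ ca d≡
  ... | _ , refl = _ , even-a , lower-even-a R d≡ d′≡ others
  abstract-inside _ d≡ d′≡ others R@(_ , _ , _ , cb , _) even4 with count-positive _ cb d≡
  ... | _ , refl = _ , even-b , lower-even-b R d≡ d′≡ others
  abstract-inside _ d≡ d′≡ others R@(_ , _ , _ , _ , cc) even6 with count-positive _ cc d≡
  ... | _ , refl = _ , even-c , lower-even-c R d≡ d′≡ others
  abstract-inside _ d≡ d′≡ others R@(_ , _ , _ , cb , _) odd3 with count-positive _ cb d≡
  ... | _ , refl = _ , odd-b , lower-odd-b R d≡ d′≡ others
  abstract-inside _ d≡ d′≡ others R@(_ , _ , _ , _ , cc) odd5 with count-positive _ cc d≡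
  ... | _ , refl = _ , odd-c , lower-odd-c R d≡ d′≡ others

  abstract-move : ∀ {d d′ s} → Realises d s → ΔStep d d′ → Σ[ s′ ∈ AState ] AMove s s′ × Realises d′ s′
  abstract-move {d} {d′} {st s _ _ _} R@(_ , vals , _) (inside p lowered others) =
    abstract-inside (d′ p) d≡ refl others R (subst (Value s) d≡ (vals p))
    where
    d≡ : d p ≡ suc (suc (d′ p))
    d≡ = trans (sym lowered) (+-comm (d′ p) 2)
  abstract-move {s = st loop _ _ _} (inj₁ u≡v , _) (hub-θ u≢v _ _ _) = ⊥-elim (u≢v u≡v)
  abstract-move {s = st loop _ _ _} (inj₂ (q , d≡0) , _) (hub-θ _ all≥1 _ _) = ⊥-elim (<-irrefl (sym d≡0) (all≥1 q))
  abstract-move {s = st evenθ _ _ _} R@(_ , vals , _) (hub-θ _ all≥1 q₀ raised) =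
    _ , even-hub (notAllZero-at R q₀ refl (vals q₀) (all≥1 q₀)) , lower-even-hub R raised
  abstract-move {s = st oddθ zero _ _} R@(_ , vals , _) (hub-θ _ all≥1 q₀ raised) =
    _ , odd-hub₀ (notAllZero-at R q₀ refl (vals q₀) (all≥1 q₀)) , lower-odd-hub₀ R raised
  abstract-move {s = st oddθ (suc _) _ _} R (hub-θ _ _ _ raised) = _ , odd-hub₁ , lower-odd-hub₁ R raised
  abstract-move {s = st loop _ _ _} R@(_ , vals , _) (hub-loop _ (q₀ , 1≤) lowered) =
    _ , loop-hub (notAllZero-at R q₀ refl (vals q₀) 1≤) , lower-loop-hub R lowered
  abstract-move {s = st evenθ _ _ _} (u≢v , _) (hub-loop (inj₁ u≡v) _ _) = ⊥-elim (u≢v u≡v)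
  abstract-move {s = st evenθ _ _ _} (h , vals , _) (hub-loop (inj₂ (q , d≡0)) _ _) = ⊥-elim (nonzero-values h vals (λ ()) q d≡0)
  abstract-move {s = st oddθ _ _ _} (u≢v , _) (hub-loop (inj₁ u≡v) _ _) = ⊥-elim (u≢v u≡v)
  abstract-move {s = st oddθ _ _ _} (h , vals , _) (hub-loop (inj₂ (q , d≡0)) _ _) = ⊥-elim (nonzero-values h vals (λ ()) q d≡0)

  MoveWith-map : ∀ {col} {R R′ : Coloring G → Set} → (∀ {col′} → R col′ → R′ col′) →
    MoveWith col R → MoveWith col R′
  MoveWith-map f (col′ , mv , bin′ , r) = col′ , mv , bin′ , f r

  via-inside : ∀ {col} y {R : Coloring G → Set} → Binary col → ∀ p → Δ col p ≡ suc (suc y) →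
    (∀ {col′} → Δ col′ p ≡ y → (∀ q → q ≢ p → Δ col′ q ≡ Δ col q) → R col′) → MoveWith col R
  via-inside y bin p Δ≡ k =
    MoveWith-map (λ (lowered , others) → k (lowered-to lowered) others)
      (interior-move _ bin p (subst (2 ≤_) (sym Δ≡) (s≤s (s≤s z≤n))))
    where
    lowered-to : ∀ {z} → z + 2 ≡ Δ _ p → z ≡ y
    lowered-to {z} e = suc-injective (suc-injective (trans (+-comm 2 z) (trans e Δ≡)))

  path-with-changes : ∀ {d s a b c} → Realises d (st s a b c) → NotAllZero a b c → Σ[ q ∈ Fin m ] 1 ≤ d q
  path-with-changes {d} {s} (_ , _ , ca , _ , _) nz₁ with count>0⇒∃ d (level s) ca
  ... | q , d≡ = q , subst (1 ≤_) (sym d≡) (level≥1 s)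
  path-with-changes {d} {s} (_ , _ , _ , cb , _) nz₂ with count>0⇒∃ d (2 + level s) cb
  ... | q , d≡ = q , subst (1 ≤_) (sym d≡) (s≤s z≤n)
  path-with-changes {d} {s} (_ , _ , _ , _ , cc) nz₃ with count>0⇒∃ d (4 + level s) cc
  ... | q , d≡ = q , subst (1 ≤_) (sym d≡) (s≤s z≤n)

  realise : ∀ {col s s′} → Binary col → Realises (Δ col) s → AMove s s′ →
    MoveWith col (λ col′ → Realises (Δ col′) s′)
  realise bin R@(fused , _) (loop-hub nz) = MoveWith-map (lower-loop-hub R) (hub-loop-move _ bin fused (path-with-changes R nz))
  realise bin R@(_ , _ , ca , _ , _) loop-a = let q , d≡ = count>0⇒∃ _ 2 ca in via-inside 0 bin q d≡ (lower-loop-a R d≡)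
  realise bin R@(_ , _ , _ , cb , _) loop-b = let q , d≡ = count>0⇒∃ _ 4 cb in via-inside 2 bin q d≡ (lower-loop-b R d≡)
  realise bin R@(_ , _ , _ , _ , cc) loop-c = let q , d≡ = count>0⇒∃ _ 6 cc in via-inside 4 bin q d≡ (lower-loop-c R d≡)
  realise bin R@(u≢v , vals , _) (even-hub nz) =
    MoveWith-map (lower-even-hub R) (hub-θ-move _ bin u≢v (nonzero-values u≢v vals (λ ())) (proj₁ (path-with-changes R nz)))
  realise bin R@(_ , _ , ca , _ , _) even-a = let q , d≡ = count>0⇒∃ _ 2 ca in via-inside 0 bin q d≡ (lower-even-a R d≡)
  realise bin R@(_ , _ , _ , cb , _) even-b = let q , d≡ = count>0⇒∃ _ 4 cb in via-inside 2 bin q d≡ (lower-even-b R d≡)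
  realise bin R@(_ , _ , _ , _ , cc) even-c = let q , d≡ = count>0⇒∃ _ 6 cc in via-inside 4 bin q d≡ (lower-even-c R d≡)
  realise bin R@(u≢v , vals , _) (odd-hub₀ nz) =
    MoveWith-map (lower-odd-hub₀ R) (hub-θ-move _ bin u≢v (nonzero-values u≢v vals (λ ())) (proj₁ (path-with-changes R nz)))
  realise bin R@(u≢v , vals , _) odd-hub₁ =
    MoveWith-map (lower-odd-hub₁ R) (hub-θ-move _ bin u≢v (nonzero-values u≢v vals (λ ())) (proj₁ (path-with-changes R nz₁)))
  realise bin R@(_ , _ , _ , cb , _) odd-b = let q , d≡ = count>0⇒∃ _ 3 cb in via-inside 1 bin q d≡ (lower-odd-b R d≡)
  realise bin R@(_ , _ , _ , _ , cc) odd-c = let q , d≡ = count>0⇒∃ _ 5 cc in via-inside 3 bin q d≡ (lower-odd-c R d≡)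

  Corresponds : AState → Set
  Corresponds s = ∀ col → Binary col → Realises (Δ col) s →
    (P-state s ≡ true → Lose G col) × (P-state s ≡ false → Win G col)

  corresponds : ∀ s → Acc _<_ (weight s) → Corresponds s
  corresponds s (acc smaller) col bin R = P⇒lose , N⇒win
    where
    next : ∀ {s′} → AMove s s′ → Corresponds s′
    next am = corresponds _ (smaller (weight-decreases am))
    P⇒lose : P-state s ≡ true → Lose G col
    P⇒lose P = lose λ col′ mv →
      let bin′ , effect = move-effect bin mv
          s′ , am , R′ = abstract-move R effect
      in proj₂ (next am col′ bin′ R′) (P⇒moves-to-N P am)
    N⇒win : P-state s ≡ false → Win G col
    N⇒win N =
      let s′ , am , P′ = N-has-move-to-P s N
          col′ , mv , bin′ , R′ = realise bin R am
      in win col′ mv (proj₁ (next am col′ bin′ R′) P′)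

  P-state⇒Lose : ∀ s col → Binary col → Realises (Δ col) s → P-state s ≡ true → Lose G col
  P-state⇒Lose s col bin R = proj₁ (corresponds s (<-wellFounded (weight s)) col bin R)

-- The label of the vertex at distance t from U on the path built by `path U V L f`.
pathLabel : ℕ → ℕ → ℕ → ℕ → ℕ → ℕ
pathLabel U V L f zero    = U
pathLabel U V L f (suc t) = if suc t ≡ᵇ L then V else f + t

pathLabel-shift : ∀ prev f v c i → pathLabel f v (suc c) (suc f) i ≡ pathLabel prev v (suc (suc c)) f (suc i)
pathLabel-shift prev f v c zero    = sym (+-identityʳ f)
pathLabel-shift prev f v c (suc j) = cong (if j ≡ᵇ c then v else_) (sym (+-suc f j))

chain-edge⁻¹ : ∀ prev t k v f a b → (a , b) ∈ proj₁ (chain prev t k v f) →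
  Σ[ i ∈ ℕ ] i ≤ k × a ≡ pathLabel prev v (suc k) f i × b ≡ pathLabel prev v (suc k) f (suc i)
chain-edge⁻¹ prev t zero    v f a b (here e) = 0 , z≤n , ,-injective e
chain-edge⁻¹ prev t (suc k) v f a b (here e) =
  0 , z≤n , proj₁ (,-injective e) , trans (proj₂ (,-injective e)) (sym (+-identityʳ f))
chain-edge⁻¹ prev t (suc k) v f a b (there e) with chain-edge⁻¹ f (suc t) k v (suc f) a b e
... | i , i≤k , a≡ , b≡ =
  suc i , s≤s i≤k , trans a≡ (pathLabel-shift prev f v k i) , trans b≡ (pathLabel-shift prev f v k (suc i))

chain-edge : ∀ prev t k v f i → i ≤ k →
  (pathLabel prev v (suc k) f i , pathLabel prev v (suc k) f (suc i)) ∈ proj₁ (chain prev t k v f)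
chain-edge prev t zero    v f zero    _ = here refl
chain-edge prev t (suc k) v f zero    _ = here (cong (prev ,_) (+-identityʳ f))
chain-edge prev t (suc k) v f (suc i) (s≤s i≤k) =
  there (subst₂ (λ a b → (a , b) ∈ proj₁ (chain f (suc t) k v (suc f)))
                (pathLabel-shift prev f v k i) (pathLabel-shift prev f v k (suc i))
                (chain-edge f (suc t) k v (suc f) i i≤k))

path-edge⁻¹ : ∀ U V L f a b → (a , b) ∈ proj₁ (path U V L f) →
  Σ[ t ∈ ℕ ] t < L × a ≡ pathLabel U V L f t × b ≡ pathLabel U V L f (suc t)
path-edge⁻¹ U V (suc zero)    f a b (here e) = 0 , s≤s z≤n , ,-injective e
path-edge⁻¹ U V (suc (suc L)) f a b e with chain-edge⁻¹ U 1 (suc L) V f a b e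
... | i , i≤ , a≡ , b≡ = i , s≤s i≤ , a≡ , b≡

path-edge : ∀ U V L f t → t < L → (pathLabel U V L f t , pathLabel U V L f (suc t)) ∈ proj₁ (path U V L f)
path-edge U V (suc zero)    f zero    _ = here refl
path-edge U V (suc zero)    f (suc t) (s≤s ())
path-edge U V (suc (suc L)) f t (s≤s t≤) = chain-edge U 1 (suc L) V f t t≤

chain-length : ∀ prev t k v f → length (proj₂ (chain prev t k v f)) ≡ k
chain-length prev t zero    v f = refl
chain-length prev t (suc k) v f = cong suc (chain-length f (suc t) k v (suc f))

path-length : ∀ U V L f → length (proj₂ (path U V L f)) ≡ L ∸ 1
path-length U V zero          f = refl
path-length U V (suc zero)    f = refl
path-length U V (suc (suc L)) f = chain-length U 1 (suc L) V f

pathLabel-end : ∀ U V L f → 1 ≤ L → pathLabel U V L f L ≡ V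
pathLabel-end U V (suc L) f _ = cong (if_then V else f + L) (≡ᵇ-refl L)

pathLabel-interior : ∀ U V L f t → 0 < t → t < L → pathLabel U V L f t ≡ f + (t ∸ 1)
pathLabel-interior U V L f (suc t) _ t< = cong (if_then V else f + t) (≡ᵇ-false (λ e → <-irrefl e t<))

-- The i-th entry of a list (junk value 0 beyond its end).
entry : List ℕ → ℕ → ℕ
entry []       _       = 0
entry (x ∷ xs) zero    = x
entry (x ∷ xs) (suc i) = entry xs i

entry-++ʳ : ∀ xs ys i → entry (xs ++ ys) (length xs + i) ≡ entry ys i
entry-++ʳ []       ys i = refl
entry-++ʳ (x ∷ xs) ys i = entry-++ʳ xs ys i

entry-++ˡ : ∀ xs ys i → i < length xs → entry (xs ++ ys) i ≡ entry xs i
entry-++ˡ (x ∷ xs) ys zero    _       = refl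
entry-++ˡ (x ∷ xs) ys (suc i) (s≤s i<) = entry-++ˡ xs ys i i<

lookup-entry : ∀ xs (i : Fin (length xs)) → lookup xs i ≡ entry xs (toℕ i)
lookup-entry (x ∷ xs) fzero    = refl
lookup-entry (x ∷ xs) (fsuc i) = lookup-entry xs i

entry-binary : ∀ {xs} → All (_< 2) xs → ∀ i → entry xs i < 2
entry-binary All.[]         i       = s≤s z≤n
entry-binary (x<2 All.∷ _)  zero    = x<2
entry-binary (_ All.∷ xs<2) (suc i) = entry-binary xs<2 i

chain-colour : ∀ prev t k v f i → i < k → entry (proj₂ (chain prev t k v f)) i ≡ (t + i) % 2
chain-colour prev t (suc k) v f zero    _        = cong (_% 2) (sym (+-identityʳ t))
chain-colour prev t (suc k) v f (suc i) (s≤s i<) = trans (chain-colour f (suc t) k v (suc f) i i<) (cong (_% 2) (sym (+-suc t i)))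

path-colour : ∀ U V L f i → i < L ∸ 1 → entry (proj₂ (path U V L f)) i ≡ suc i % 2
path-colour U V (suc (suc L)) f i i< = chain-colour U 1 (suc L) V f i i<

chain-binary : ∀ prev t k v f → All (_< 2) (proj₂ (chain prev t k v f))
chain-binary prev t zero    v f = All.[]
chain-binary prev t (suc k) v f = m%n<n t 2 All.∷ chain-binary f (suc t) k v (suc f)

path-binary : ∀ U V L f → All (_< 2) (proj₂ (path U V L f))
path-binary U V zero          f = All.[]
path-binary U V (suc zero)    f = All.[]
path-binary U V (suc (suc L)) f = chain-binary U 1 (suc L) V f

-- Path q of `paths U V Ls f` has its interior labels from f + offset Ls q on.
offset : (Ls : List ℕ) → Fin (length Ls) → ℕ
offset (L ∷ Ls) fzero    = 0
offset (L ∷ Ls) (fsuc q) = (L ∸ 1) + offset Ls q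

interiorCount : List ℕ → ℕ
interiorCount []       = 0
interiorCount (L ∷ Ls) = (L ∸ 1) + interiorCount Ls

paths-length : ∀ U V Ls f → length (proj₂ (paths U V Ls f)) ≡ interiorCount Ls
paths-length U V []       f = refl
paths-length U V (L ∷ Ls) f = trans (length-++ (proj₂ (path U V L f)))
  (cong₂ _+_ (path-length U V L f) (paths-length U V Ls (f + length (proj₂ (path U V L f)))))

pathsLabel : ℕ → ℕ → (Ls : List ℕ) → ℕ → Fin (length Ls) → ℕ → ℕ
pathsLabel U V Ls f q = pathLabel U V (lookup Ls q) (f + offset Ls q)

pathsLabel-fzero : ∀ U V L Ls f t → pathLabel U V L f t ≡ pathsLabel U V (L ∷ Ls) f fzero t
pathsLabel-fzero U V L Ls f t = cong (λ g → pathLabel U V L g t) (sym (+-identityʳ f))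

pathsLabel-fsuc : ∀ U V L Ls f q t →
  pathsLabel U V Ls (f + length (proj₂ (path U V L f))) q t ≡ pathsLabel U V (L ∷ Ls) f (fsuc q) t
pathsLabel-fsuc U V L Ls f q t = cong (λ g → pathLabel U V (lookup Ls q) g t)
  (trans (cong (λ k → f + k + offset Ls q) (path-length U V L f)) (+-assoc f (L ∸ 1) (offset Ls q)))

paths-edge⁻¹ : ∀ U V Ls f a b → (a , b) ∈ proj₁ (paths U V Ls f) →
  Σ[ q ∈ Fin (length Ls) ] Σ[ t ∈ ℕ ] t < lookup Ls q × a ≡ pathsLabel U V Ls f q t × b ≡ pathsLabel U V Ls f q (suc t)
paths-edge⁻¹ U V (L ∷ Ls) f a b e with ∈-++⁻ (proj₁ (path U V L f)) e
... | inj₁ e₁ with path-edge⁻¹ U V L f a b e₁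
...   | t , t< , a≡ , b≡ =
  fzero , t , t< , trans a≡ (pathsLabel-fzero U V L Ls f t) , trans b≡ (pathsLabel-fzero U V L Ls f (suc t))
paths-edge⁻¹ U V (L ∷ Ls) f a b e | inj₂ e₂ with paths-edge⁻¹ U V Ls _ a b e₂
... | q , t , t< , a≡ , b≡ =
  fsuc q , t , t< , trans a≡ (pathsLabel-fsuc U V L Ls f q t) , trans b≡ (pathsLabel-fsuc U V L Ls f q (suc t))

paths-edge : ∀ U V Ls f q t → t < lookup Ls q → (pathsLabel U V Ls f q t , pathsLabel U V Ls f q (suc t)) ∈ proj₁ (paths U V Ls f)
paths-edge U V (L ∷ Ls) f fzero t t< = ∈-++⁺ˡ
  (subst₂ (λ a b → (a , b) ∈ proj₁ (path U V L f)) (pathsLabel-fzero U V L Ls f t) (pathsLabel-fzero U V L Ls f (suc t))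
          (path-edge U V L f t t<))
paths-edge U V (L ∷ Ls) f (fsuc q) t t< = ∈-++⁺ʳ (proj₁ (path U V L f))
  (subst₂ (λ a b → (a , b) ∈ proj₁ (paths U V Ls _)) (pathsLabel-fsuc U V L Ls f q t) (pathsLabel-fsuc U V L Ls f q (suc t))
          (paths-edge U V Ls _ q t t<))

paths-colour : ∀ U V Ls f q i → i < lookup Ls q ∸ 1 → entry (proj₂ (paths U V Ls f)) (offset Ls q + i) ≡ suc i % 2
paths-colour U V (L ∷ Ls) f fzero i i< =
  trans (entry-++ˡ (proj₂ (path U V L f)) _ i (subst (i <_) (sym (path-length U V L f)) i<)) (path-colour U V L f i i<)
paths-colour U V (L ∷ Ls) f (fsuc q) i i< =
  trans (cong (entry (proj₂ (path U V L f) ++ proj₂ (paths U V Ls (f + length (proj₂ (path U V L f))))))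
              (trans (+-assoc (L ∸ 1) (offset Ls q) i) (cong (_+ (offset Ls q + i)) (sym (path-length U V L f)))))
        (trans (entry-++ʳ (proj₂ (path U V L f)) _ (offset Ls q + i)) (paths-colour U V Ls _ q i i<))

paths-binary : ∀ U V Ls f → All (_< 2) (proj₂ (paths U V Ls f))
paths-binary U V []       f = All.[]
paths-binary U V (L ∷ Ls) f = ++⁺ (path-binary U V L f) (paths-binary U V Ls _)

offset-fsuc : ∀ L Ls q i → offset (L ∷ Ls) (fsuc q) + i ≡ (L ∸ 1) + (offset Ls q + i)
offset-fsuc L Ls q i = +-assoc (L ∸ 1) (offset Ls q) i

offset-injective : ∀ Ls q q′ i i′ → i < lookup Ls q ∸ 1 → i′ < lookup Ls q′ ∸ 1 →
  offset Ls q + i ≡ offset Ls q′ + i′ → q ≡ q′ × i ≡ i′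
offset-injective (L ∷ Ls) fzero    fzero     i i′ _  _   e = refl , e
offset-injective (L ∷ Ls) fzero    (fsuc q′) i i′ i< _   e =
  ⊥-elim (<⇒≱ i< (subst (L ∸ 1 ≤_) (sym (trans e (offset-fsuc L Ls q′ i′))) (m≤m+n (L ∸ 1) _)))
offset-injective (L ∷ Ls) (fsuc q) fzero     i i′ _  i′< e =
  ⊥-elim (<⇒≱ i′< (subst (L ∸ 1 ≤_) (trans (sym (offset-fsuc L Ls q i)) e) (m≤m+n (L ∸ 1) _)))
offset-injective (L ∷ Ls) (fsuc q) (fsuc q′) i i′ i< i′< e
  with offset-injective Ls q q′ i i′ i< i′<
         (+-cancelˡ-≡ (L ∸ 1) _ _ (trans (sym (offset-fsuc L Ls q i)) (trans e (offset-fsuc L Ls q′ i′))))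
... | refl , refl = refl , refl

offset< : ∀ Ls q i → i < lookup Ls q ∸ 1 → offset Ls q + i < interiorCount Ls
offset< (L ∷ Ls) fzero    i i< = ≤-trans i< (m≤m+n (L ∸ 1) (interiorCount Ls))
offset< (L ∷ Ls) (fsuc q) i i< = subst (_< (L ∸ 1) + interiorCount Ls) (sym (offset-fsuc L Ls q i))
                                         (+-monoʳ-< (L ∸ 1) (offset< Ls q i i<))

offset-surjective : ∀ Ls r → r < interiorCount Ls →
  Σ[ q ∈ Fin (length Ls) ] Σ[ i ∈ ℕ ] i < lookup Ls q ∸ 1 × r ≡ offset Ls q + i
offset-surjective (L ∷ Ls) r r< with r <? (L ∸ 1)
... | yes r<L = fzero , r , r<L , refl
... | no  r≮L with offset-surjective Ls (r ∸ (L ∸ 1))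
                    (+-cancelˡ-< (L ∸ 1) _ _ (subst (_< (L ∸ 1) + interiorCount Ls) (sym (m+[n∸m]≡n (≮⇒≥ r≮L))) r<))
...   | q , i , i< , r≡ = fsuc q , i , i< ,
          trans (sym (m+[n∸m]≡n (≮⇒≥ r≮L))) (trans (cong ((L ∸ 1) +_) r≡) (sym (+-assoc (L ∸ 1) (offset Ls q) i)))

pred-< : ∀ L t → 0 < t → t < L → t ∸ 1 < L ∸ 1
pred-< (suc L) (suc t) _ (s≤s t<) = t<

parity-alternates : ∀ n → n % 2 ≢ suc n % 2
parity-alternates zero          ()
parity-alternates (suc zero)    ()
parity-alternates (suc (suc n)) e = parity-alternates n (trans (sym (%2-suc-suc n)) (trans e (%2-suc-suc (suc n))))

-- The hub vertices have the labels below length hubColours; the paths follow.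
module PathsGraph (U V : ℕ) (hubColours Ls : List ℕ) (U< : U < length hubColours) (V< : V < length hubColours)
  (hubs : ∀ a → a < length hubColours → a ≡ U ⊎ a ≡ V) (nonempty : ∀ q → 1 ≤ lookup Ls q) where

  F : ℕ
  F = length hubColours
  es : List (ℕ × ℕ)
  es = proj₁ (paths U V Ls F)
  cs : List ℕ
  cs = proj₂ (paths U V Ls F)

  graphOf : Graph
  graphOf = record { n = length (hubColours ++ cs) ; edges = es }

  size≡ : n graphOf ≡ F + interiorCount Ls
  size≡ = trans (length-++ hubColours) (cong (F +_) (paths-length U V Ls F))

  F≤n : F ≤ n graphOf
  F≤n = subst (F ≤_) (sym size≡) (m≤m+n F (interiorCount Ls))

  label : Fin (length Ls) → ℕ → ℕ
  label = pathsLabel U V Ls F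

  label-len : ∀ q → label q (lookup Ls q) ≡ V
  label-len q = pathLabel-end U V (lookup Ls q) _ (nonempty q)

  label-interior : ∀ q t → 0 < t → t < lookup Ls q → label q t ≡ F + (offset Ls q + (t ∸ 1))
  label-interior q t 0<t t< = trans (pathLabel-interior U V (lookup Ls q) (F + offset Ls q) t 0<t t<) (+-assoc F (offset Ls q) (t ∸ 1))

  data PositionKind (q : Fin (length Ls)) (t : ℕ) : Set where
    start    : t ≡ 0 → PositionKind q t
    end      : t ≡ lookup Ls q → PositionKind q t
    interior : 0 < t → t < lookup Ls q → PositionKind q t

  kind : ∀ q t → t ≤ lookup Ls q → PositionKind q t
  kind q t t≤ with t ≟ 0 | t ≟ lookup Ls q
  ... | yes t≡0 | _        = start t≡0
  ... | no  _   | yes t≡L  = end t≡L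
  ... | no  t≢0 | no  t≢L  = interior (n≢0⇒n>0 t≢0) (≤∧≢⇒< t≤ t≢L)

  label<n : ∀ q t → t ≤ lookup Ls q → label q t < n graphOf
  label<n q t t≤ with kind q t t≤
  ... | start refl        = ≤-trans U< F≤n
  ... | end refl          = subst (_< n graphOf) (sym (label-len q)) (≤-trans V< F≤n)
  ... | interior 0<t t<   = subst (_< n graphOf) (sym (label-interior q t 0<t t<))
          (subst (F + (offset Ls q + (t ∸ 1)) <_) (sym size≡) (+-monoʳ-< F (offset< Ls q (t ∸ 1) (pred-< _ t 0<t t<))))

  covers : ∀ a → a < n graphOf →
    a ≡ U ⊎ a ≡ V ⊎ (Σ[ q ∈ Fin (length Ls) ] Σ[ t ∈ ℕ ] 0 < t × t < lookup Ls q × a ≡ label q t)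
  covers a a< with a <? F
  ... | yes a<F = ⊎-map₂ inj₁ (hubs a a<F)
  ... | no  a≮F with offset-surjective Ls (a ∸ F)
                       (+-cancelˡ-< F _ _
                         (subst (_< F + interiorCount Ls) (sym (m+[n∸m]≡n (≮⇒≥ a≮F))) (subst (a <_) size≡ a<)))
  ...   | q , i , i< , a≡ = inj₂ (inj₂ (q , suc i , s≤s z≤n , s≤s′ i< ,
            trans (sym (m+[n∸m]≡n (≮⇒≥ a≮F)))
              (trans (cong (F +_) a≡) (sym (label-interior q (suc i) (s≤s z≤n) (s≤s′ i<))))))
    where
    s≤s′ : ∀ {i L} → i < L ∸ 1 → suc i < L
    s≤s′ {L = suc L} i< = s≤s i<

  interior≥F : ∀ q t → 0 < t → t < lookup Ls q → F ≤ label q t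
  interior≥F q t 0<t t< = subst (F ≤_) (sym (label-interior q t 0<t t<)) (m≤m+n F _)

  interior-unique : ∀ q t q′ t′ → 0 < t → t < lookup Ls q → t′ ≤ lookup Ls q′ →
    label q t ≡ label q′ t′ → q ≡ q′ × t ≡ t′
  interior-unique q t q′ t′ 0<t t< t′≤ e with kind q′ t′ t′≤
  ... | start refl = ⊥-elim (<⇒≱ U< (subst (F ≤_) e (interior≥F q t 0<t t<)))
  ... | end refl   = ⊥-elim (<⇒≱ V< (subst (F ≤_) (trans e (label-len q′)) (interior≥F q t 0<t t<)))
  ... | interior 0<t′ t′<
    with offset-injective Ls q q′ (t ∸ 1) (t′ ∸ 1) (pred-< _ t 0<t t<) (pred-< _ t′ 0<t′ t′<)
           (+-cancelˡ-≡ F _ _ (trans (sym (label-interior q t 0<t t<)) (trans e (label-interior q′ t′ 0<t′ t′<))))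
  ...   | refl , t∸1≡ = refl , ∸1-injective 0<t 0<t′ t∸1≡
    where
    ∸1-injective : ∀ {t t′} → 0 < t → 0 < t′ → t ∸ 1 ≡ t′ ∸ 1 → t ≡ t′
    ∸1-injective {suc t} {suc t′} _ _ e = cong suc e

  system : PathSystem
  system = record
    { G = graphOf ; m = length Ls ; len = lookup Ls ; u = U ; v = V
    ; u<n = ≤-trans U< F≤n ; v<n = ≤-trans V< F≤n
    ; label = label ; label-0 = λ _ → refl ; label-len = label-len ; label<n = label<n
    ; edge-along-path = paths-edge U V Ls F ; edge-on-path = paths-edge⁻¹ U V Ls F
    ; covers = covers ; interior-unique = interior-unique }

  open Colourings system using (Δ; Binary; colourOf; colourOf-fromℕ<; word)

  -- The proper 2-colouring of Defs: the vertex at distance t from U along a path has colour t % 2.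
  initial : Coloring graphOf
  initial = lookup (hubColours ++ cs)

  colourOf-initial : ∀ a → a < n graphOf → colourOf initial a ≡ entry (hubColours ++ cs) a
  colourOf-initial a a< = trans (colourOf-fromℕ< initial a a<)
    (trans (lookup-entry (hubColours ++ cs) (fromℕ< a<)) (cong (entry (hubColours ++ cs)) (toℕ-fromℕ< a<)))

  module _ (U-colour : entry hubColours U ≡ 0) (V-colour : ∀ q → entry hubColours V ≡ lookup Ls q % 2) where

    word-initial : ∀ q t → t ≤ lookup Ls q → word initial q t ≡ t % 2
    word-initial q t t≤ with kind q t t≤
    ... | start refl = trans (colourOf-initial U (≤-trans U< F≤n)) (trans (entry-++ˡ hubColours cs U U<) U-colour)
    ... | end refl = trans (cong (colourOf initial) (label-len q))
          (trans (colourOf-initial V (≤-trans V< F≤n)) (trans (entry-++ˡ hubColours cs V V<) (V-colour q)))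
    ... | interior 0<t t< = trans (cong (colourOf initial) (label-interior q t 0<t t<))
          (trans (colourOf-initial _ (subst (_< n graphOf) (label-interior q t 0<t t<) (label<n q t t≤)))
          (trans (entry-++ʳ hubColours cs (offset Ls q + (t ∸ 1)))
          (trans (paths-colour U V Ls F q (t ∸ 1) (pred-< _ t 0<t t<)) (cong (_% 2) (suc[t∸1] 0<t)))))
      where
      suc[t∸1] : ∀ {t} → 0 < t → suc (t ∸ 1) ≡ t
      suc[t∸1] {suc t} _ = refl

    Δ-initial : ∀ q → Δ initial q ≡ lookup Ls q
    Δ-initial q = changes-alternating (word initial q) (lookup Ls q)
      (λ t t< e → parity-alternates t (trans (sym (word-initial q t (<⇒≤ t<))) (trans e (word-initial q (suc t) t<))))

  initial-binary : All (_< 2) hubColours → Binary initial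
  initial-binary hub-binary y = subst (_< 2) (sym (lookup-entry (hubColours ++ cs) y))
    (entry-binary (++⁺ hub-binary (paths-binary U V Ls F)) (toℕ y))

isEven-sucᶜ² : ∀ x → isEven (sucᶜ (sucᶜ x)) ≡ isEven x
isEven-sucᶜ² k0    = refl
isEven-sucᶜ² k1    = refl
isEven-sucᶜ² k2    = refl
isEven-sucᶜ² kOdd  = refl
isEven-sucᶜ² kEven = refl

isEven-class-even : ∀ n → Even n → isEven (class n) ≡ true
isEven-class-even zero          _ = refl
isEven-class-even (suc (suc n)) e = trans (isEven-sucᶜ² (class n)) (isEven-class-even n (trans (sym (%2-suc-suc n)) e))

isEven-class-odd : ∀ n → Odd n → isEven (class n) ≡ false
isEven-class-odd (suc zero)    _ = refl
isEven-class-odd (suc (suc n)) o = trans (isEven-sucᶜ² (class n)) (isEven-class-odd n (trans (sym (%2-suc-suc n)) o))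

class-odd≥3 : ∀ n → 3 ≤ n → Odd n → class n ≡ kOdd
class-odd≥3 (suc zero)                      (s≤s ()) _
class-odd≥3 (suc (suc (suc zero)))          _ _ = refl
class-odd≥3 (suc (suc (suc (suc (suc n))))) _ o =
  cong (sucᶜ ∘ sucᶜ)
    (class-odd≥3 (suc (suc (suc n))) (s≤s (s≤s (s≤s z≤n))) (trans (sym (%2-suc-suc (suc (suc (suc n))))) o))

data Large : Class → Set where
  large2    : Large k2
  largeOdd  : Large kOdd
  largeEven : Large kEven

class-large : ∀ n → 2 ≤ n → Large (class n)
class-large (suc zero)    (s≤s ())
class-large (suc (suc n)) _ = sucᶜ²-large (class n)
  where
  sucᶜ²-large : ∀ x → Large (sucᶜ (sucᶜ x))
  sucᶜ²-large k0    = large2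
  sucᶜ²-large k1    = largeOdd
  sucᶜ²-large k2    = largeEven
  sucᶜ²-large kOdd  = largeOdd
  sucᶜ²-large kEven = largeEven

is1-class : ∀ n → n ≢ 1 → is1 (class n) ≡ false
is1-class zero          _   = refl
is1-class (suc zero)    n≢1 = ⊥-elim (n≢1 refl)
is1-class (suc (suc n)) _   with class (suc (suc n)) | class-large (suc (suc n)) (s≤s (s≤s z≤n))
... | _ | large2    = refl
... | _ | largeOdd  = refl
... | _ | largeEven = refl

is0-class-suc : ∀ n → is0 (class (suc n)) ≡ false
is0-class-suc n = is0-sucᶜ (class n)

P-odd-k0-sucᶜ : ∀ b x → P-odd k0 b (sucᶜ x) ≡ not (isEven b)
P-odd-k0-sucᶜ b k0    = refl
P-odd-k0-sucᶜ b k1    = refl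
P-odd-k0-sucᶜ b k2    = refl
P-odd-k0-sucᶜ b kOdd  = refl
P-odd-k0-sucᶜ b kEven = refl

P0246-table₁ : ∀ i j → Odd i → Odd j → P-state (st loop i j 1) ≡ true
P0246-table₁ i j oi oj rewrite isEven-class-odd i oi | isEven-class-odd j oj = refl

P0246-table₂ : ∀ i j k → 2 ≤ k → Even i → Odd j → P-state (st loop i j k) ≡ true
P0246-table₂ i j k 2≤k ei oj with class k | class-large k 2≤k
... | _ | large2    rewrite isEven-class-even i ei | isEven-class-odd j oj = refl
... | _ | largeOdd  rewrite isEven-class-even i ei | isEven-class-odd j oj = refl
... | _ | largeEven rewrite isEven-class-even i ei | isEven-class-odd j oj = refl

P135-table : ∀ i j → Odd i → P-state (st oddθ 1 i j) ≡ true
P135-table i j oi rewrite isEven-class-odd i oi = refl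

P246-table₀ : ∀ i j → (i ≡ 0 × j ≢ 1) ⊎ (2 ≤ i × Even i × Even j) ⊎ (3 ≤ i × Odd i × j ≡ 0) →
  P-state (st evenθ i j 0) ≡ true
P246-table₀ .0      j  (inj₁ (refl , j≢1)) rewrite is1-class j j≢1 = refl
P246-table₀ (suc i) j  (inj₂ (inj₁ (_ , ei , ej)))
  rewrite is0-class-suc i | isEven-class-even (suc i) ei | isEven-class-even j ej = refl
P246-table₀ i       .0 (inj₂ (inj₂ (3≤i , oi , refl))) rewrite class-odd≥3 i 3≤i oi = refl

P246-table₁ : ∀ i j → (i ≡ 0 × j ≡ 0) ⊎ (1 ≤ i × Even j) → P-state (st evenθ i j 1) ≡ true
P246-table₁ .0      .0 (inj₁ (refl , refl)) = refl
P246-table₁ (suc i) j  (inj₂ (_ , ej)) rewrite is0-class-suc i | isEven-class-even j ej = refl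

P246-table₂ : ∀ i j k → 2 ≤ k → Even j → P-state (st evenθ i j k) ≡ true
P246-table₂ i j k 2≤k ej with class k | class-large k 2≤k
... | _ | large2    rewrite isEven-class-even j ej = refl
... | _ | largeOdd  rewrite isEven-class-even j ej = refl
... | _ | largeEven rewrite isEven-class-even j ej = refl

P35-table : ∀ i j → (i ≡ 0 × j ≡ 0) ⊎ i ≡ 1 ⊎ (3 ≤ i × Odd i × 1 ≤ j) → P-state (st oddθ 0 i j) ≡ true
P35-table .0 .0      (inj₁ (refl , refl))         = refl
P35-table .1 zero    (inj₂ (inj₁ refl))           = refl
P35-table .1 (suc j) (inj₂ (inj₁ refl))           = P-odd-k0-sucᶜ k1 (class j)
P35-table i  (suc j) (inj₂ (inj₂ (3≤i , oi , _))) rewrite class-odd≥3 i 3≤i oi = P-odd-k0-sucᶜ kOdd (class j)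

blocks : ℕ → ℕ → ℕ → ℕ → ℕ → ℕ → List ℕ
blocks x y z a b c = replicate a x ++ replicate b y ++ replicate c z

count-lookup-++ : ∀ xs ys v → count (lookup (xs ++ ys)) v ≡ count (lookup xs) v + count (lookup ys) v
count-lookup-++ []       ys v = refl
count-lookup-++ (x ∷ xs) ys v = trans (cong (δ v x +_) (count-lookup-++ xs ys v)) (sym (+-assoc (δ v x) _ _))

count-lookup-replicate : ∀ a x v → count (lookup (replicate a x)) v ≡ a * δ v x
count-lookup-replicate zero    x v = refl
count-lookup-replicate (suc a) x v = cong (δ v x +_) (count-lookup-replicate a x v)

count-blocks : ∀ x y z a b c v → count (lookup (blocks x y z a b c)) v ≡ a * δ v x + (b * δ v y + c * δ v z)
count-blocks x y z a b c v = trans (count-lookup-++ (replicate a x) _ v)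
  (cong₂ _+_ (count-lookup-replicate a x v)
             (trans (count-lookup-++ (replicate b y) _ v)
                    (cong₂ _+_ (count-lookup-replicate b y v) (count-lookup-replicate c z v))))

only-a : ∀ a b c → a * 1 + (b * 0 + c * 0) ≡ a
only-a a b c rewrite *-identityʳ a | *-zeroʳ b | *-zeroʳ c = +-identityʳ a

only-b : ∀ a b c → a * 0 + (b * 1 + c * 0) ≡ b
only-b a b c rewrite *-zeroʳ a | *-identityʳ b | *-zeroʳ c = +-identityʳ b

only-c : ∀ a b c → a * 0 + (b * 0 + c * 1) ≡ c
only-c a b c rewrite *-zeroʳ a | *-zeroʳ b | *-identityʳ c = refl

level-value : ∀ s → Value s (level s) × Value s (2 + level s) × Value s (4 + level s)
level-value loop  = loop2 , loop4 , loop6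
level-value evenθ = even2 , even4 , even6
level-value oddθ  = odd1 , odd3 , odd5

level-δ : ∀ s a b c → let w v = a * δ v (level s) + (b * δ v (2 + level s) + c * δ v (4 + level s)) in
  w (level s) ≡ a × w (2 + level s) ≡ b × w (4 + level s) ≡ c
level-δ loop  a b c = only-a a b c , only-b a b c , only-c a b c
level-δ evenθ a b c = only-a a b c , only-b a b c , only-c a b c
level-δ oddθ  a b c = only-a a b c , only-b a b c , only-c a b c

module BlocksGraph (s : Shape) (U V : ℕ) (hubColours : List ℕ) (U< : U < length hubColours) (V< : V < length hubColours)
  (hubs : ∀ a → a < length hubColours → a ≡ U ⊎ a ≡ V) (hub-binary : All (_< 2) hubColours)
  (U-colour : entry hubColours U ≡ 0) (V-colour : entry hubColours V ≡ level s % 2) (a b c : ℕ) where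

  Ls : List ℕ
  Ls = blocks (level s) (2 + level s) (4 + level s) a b c

  on-blocks : ∀ {P : ℕ → Set} → P (level s) → P (2 + level s) → P (4 + level s) → ∀ q → P (lookup Ls q)
  on-blocks {P} Pa Pb Pc q = All.lookup all (∈-lookup q)
    where
    all : All P Ls
    all = ++⁺ (replicate⁺ a Pa) (++⁺ (replicate⁺ b Pb) (replicate⁺ c Pc))

  open PathsGraph U V hubColours Ls U< V< hubs
    (on-blocks {1 ≤_} (level≥1 s) (m≤n⇒m≤1+n (m≤n⇒m≤1+n (level≥1 s))) (≤-trans (level≥1 s) (m≤n+m (level s) 4)))
    public
  open Colourings system using (Δ)
  open Simulation system

  parity : ∀ q → entry hubColours V ≡ lookup Ls q % 2
  parity = on-blocks {λ x → entry hubColours V ≡ x % 2} V-colour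
    (trans V-colour (sym (%2-suc-suc (level s))))
    (trans V-colour (sym (trans (%2-suc-suc (2 + level s)) (%2-suc-suc (level s)))))

  counts : ∀ v → count (Δ initial) v ≡ a * δ v (level s) + (b * δ v (2 + level s) + c * δ v (4 + level s))
  counts v = trans (count-cong v (Δ-initial U-colour parity)) (count-blocks (level s) (2 + level s) (4 + level s) a b c v)

  initial-realises : HubCondition s (Δ initial) → Realises (Δ initial) (st s a b c)
  initial-realises h = h
    , (λ q → subst (Value s) (sym (Δ-initial U-colour parity q)) (on-blocks {Value s} va vb vc q))
    , trans (counts (level s)) (proj₁ (level-δ s a b c))
    , trans (counts (2 + level s)) (proj₁ (proj₂ (level-δ s a b c)))
    , trans (counts (4 + level s)) (proj₂ (proj₂ (level-δ s a b c)))
    where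
    va : Value s (level s)
    va = proj₁ (level-value s)
    vb : Value s (2 + level s)
    vb = proj₁ (proj₂ (level-value s))
    vc : Value s (4 + level s)
    vc = proj₂ (proj₂ (level-value s))

  blocks-P : HubCondition s (Δ initial) → P-state (st s a b c) ≡ true → Lose graphOf initial
  blocks-P h = P-state⇒Lose (st s a b c) initial (initial-binary hub-binary) (initial-realises h)

below-2 : ∀ a → a < 2 → a ≡ 0 ⊎ a ≡ 1
below-2 zero       _ = inj₁ refl
below-2 (suc zero) _ = inj₂ refl
below-2 (suc (suc a)) (s≤s (s≤s ()))

below-1 : ∀ a → a < 1 → a ≡ 0 ⊎ a ≡ 0
below-1 zero _ = inj₁ refl
below-1 (suc a) (s≤s ())

P246-is-P : ∀ i j k → P-state (st evenθ i j k) ≡ true → IsP (P246 i j k)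
P246-is-P i j k = BlocksGraph.blocks-P evenθ 0 1 (0 ∷ 0 ∷ []) (s≤s z≤n) (s≤s (s≤s z≤n)) below-2
  (s≤s z≤n All.∷ s≤s z≤n All.∷ All.[]) refl refl i j k (λ ())

P0246-is-P : ∀ i j k → P-state (st loop i j k) ≡ true → IsP (P0246 i j k)
P0246-is-P i j k = BlocksGraph.blocks-P loop 0 0 (0 ∷ []) (s≤s z≤n) (s≤s z≤n) below-1
  (s≤s z≤n All.∷ All.[]) refl refl i j k (inj₁ refl)

-- P35 i j and P135 i j are the θ-graphs of blocks 1 3 5 0 i j and blocks 1 3 5 1 i j.
oddθ-is-P : ∀ a i j → P-state (st oddθ a i j) ≡ true → IsP (theta 1 (blocks 1 3 5 a i j))
oddθ-is-P a i j = BlocksGraph.blocks-P oddθ 0 1 (0 ∷ 1 ∷ []) (s≤s z≤n) (s≤s (s≤s z≤n)) below-2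
  (s≤s z≤n All.∷ s≤s (s≤s z≤n) All.∷ All.[]) refl refl a i j (λ ())

lemma2 : (∀ i j → Odd i → Odd j → IsP (P0246 i j 1))
    × (∀ i j k → 2 ≤ k → Even i → Odd j → IsP (P0246 i j k))
    × (∀ i j → Odd i → IsP (P135 i j))
    × (∀ i j → ((i ≡ 0 × j ≢ 1) ⊎ (2 ≤ i × Even i × Even j) ⊎ (3 ≤ i × Odd i × j ≡ 0))
    → IsP (P246 i j 0))
    × (∀ i j → ((i ≡ 0 × j ≡ 0) ⊎ (1 ≤ i × Even j)) → IsP (P246 i j 1))
    × (∀ i j k → 2 ≤ k → Even j → IsP (P246 i j k))
    × (∀ i j → ((i ≡ 0 × j ≡ 0) ⊎ i ≡ 1 ⊎ (3 ≤ i × Odd i × 1 ≤ j)) → IsP (P35 i j))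
lemma2 =
    (λ i j oi oj → P0246-is-P i j 1 (P0246-table₁ i j oi oj))
  , (λ i j k 2≤k ei oj → P0246-is-P i j k (P0246-table₂ i j k 2≤k ei oj))
  , (λ i j oi → oddθ-is-P 1 i j (P135-table i j oi))
  , (λ i j h → P246-is-P i j 0 (P246-table₀ i j h))
  , (λ i j h → P246-is-P i j 1 (P246-table₁ i j h))
  , (λ i j k 2≤k ej → P246-is-P i j k (P246-table₂ i j k 2≤k ej))
  , (λ i j h → oddθ-is-P 0 i j (P35-table i j h))
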